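{- For $n\ge1$, $$e_n=\det\begin{pmatrix} h_1&h_2&h_3&\cdots&h_{n-1}&h_n\\ 1&h_1&h_2&\cdots&h_{n-2}&h_{n-1}\\ 0&1&h_1&\cdots&h_{n-3}&h_{n-2}\\ \vdots&&\ddots&\ddots&&\vdots\\ 0&0&0&\cdots&1&h_1\end{pmatrix}.$$ For $n\ge0$, $$\tilde e_n=\frac1{n!}\det\begin{pmatrix}\tilde h_0&\tilde h_1&\tilde h_2&\cdots&\tilde h_{n-1}&\tilde h_n\\ n&(n+1)h_1&(n+2)h_2&\cdots&(2n-1)h_{n-1}&2nh_n\\ 0&n-1&nh_1&\cdots&(2n-3)h_{n-2}&(2n-2)h_{n-1}\\ 0&0&n-2&\cdots&(2n-5)h_{n-3}&(2n-4)h_{n-2}\\ \vdots&&\ddots&\ddots&&\vdots\\ 0&0&0&\cdots&1&2h_1\end{pmatrix},$$ i.e. the $(n+1)\times(n+1)$ matrix whose first row is $(\tilde h_0,\ldots,\tilde h_n)$ and whose entry in row $i\ge2$, column $j$ is $(n+3-2i+j)h_{j-i+1}$ if $j\ge i-1$ (with $h_0=1$) and $0$ otherwise; the determinant is expanded along the first row.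
   Context: Variables $x_1,x_2,\ldots$ commute; $\theta_1,\theta_2,\ldots$ anticommute among themselves and commute with the $x$'s. A superpartition of $(n|m)$ is $\Lambda=(\Lambda_1,\ldots,\Lambda_m;\Lambda_{m+1},\ldots)$ with $\Lambda_1>\cdots>\Lambda_m\ge0$, $\Lambda_{m+1}\ge\cdots\ge0$, total sum $n$; $m_\Lambda$ is the sum of all distinct terms $\theta_{i_1}\cdots\theta_{i_m}x_{i_1}^{\Lambda_1}\cdots x_{i_m}^{\Lambda_m}x_{j_1}^{\Lambda_{m+1}}\cdots$ over distinct indices. $e_n=\sum_{j_1<\cdots<j_n}x_{j_1}\cdots x_{j_n}$; $\tilde e_n=\sum_i\theta_i\sum_{j_1<\cdots<j_n,\,i\notin\{j_k\}}x_{j_1}\cdots x_{j_n}$; $h_n=\sum_{\lambda\vdash n}m_\lambda$; $\tilde h_n=\sum_{\Lambda\in\mathrm{SPar}(n|1)}(\Lambda_1+1)m_\Lambda$ (sum over superpartitions of $(n|1)$). -}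

module Defs where

open import Data.Bool using (Bool; true; false; if_then_else_; _∧_; not; _xor_)
open import Data.Nat as ℕ using (ℕ; zero; suc; _∸_; _≤ᵇ_; _≡ᵇ_; _!)
open import Data.Nat.Properties using (_!≢0)
open import Data.Integer using (+_)
open import Data.Rational as ℚ using (ℚ; 0ℚ; 1ℚ; _/_)
open import Data.List as L using (List; []; _∷_; concatMap; upTo; allFin; foldr; filter)
open import Data.List.Properties using (≡-dec)
open import Data.Vec as V using (Vec; []; _∷_)
open import Data.Fin as F using (Fin; toℕ; punchIn)
open import Data.Product using (_×_; _,_)
open import Relation.Nullary using (does)

-- Superpolynomials in N variables x₁..x_N, θ₁..θ_N with rational
-- coefficients.  A basis monomial is θ_{s₁}⋯θ_{s_k} x^α with
-- s₁ < ⋯ < s_k (indices in increasing order); it is encoded by the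
-- exponent vector α and the indicator vector S of {s₁,…,s_k}.

Mon : ℕ → Set
Mon N = Vec ℕ N × Vec Bool N

SP : ℕ → Set
SP N = Mon N → ℚ

_≋_ : ∀ {N} → SP N → SP N → Set
f ≋ g = ∀ μ → f μ ≡ g μ
  where open import Relation.Binary.PropositionalEquality using (_≡_)

0sp : ∀ {N} → SP N
0sp _ = 0ℚ

allZero : ∀ {N} → Vec ℕ N → Bool
allZero [] = true
allZero (a ∷ α) = (a ≡ᵇ 0) ∧ allZero α

noneTrue : ∀ {N} → Vec Bool N → Bool
noneTrue [] = true
noneTrue (s ∷ S) = not s ∧ noneTrue S

1sp : ∀ {N} → SP N
1sp (α , S) = if allZero α ∧ noneTrue S then 1ℚ else 0ℚ

_+sp_ : ∀ {N} → SP N → SP N → SP N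
(f +sp g) μ = f μ ℚ.+ g μ

_•_ : ∀ {N} → ℚ → SP N → SP N
(c • f) μ = c ℚ.* f μ

sign : Bool → ℚ
sign true  = ℚ.- 1ℚ
sign false = 1ℚ

countTrue : ∀ {N} → Vec Bool N → ℕ
countTrue [] = 0
countTrue (s ∷ S) = (if s then 1 else 0) ℕ.+ countTrue S

odd : ℕ → Bool
odd zero = false
odd (suc n) = not (odd n)

-- All ways to write θ_S x^α = ± (θ_T x^β)(θ_U x^γ) with α = β + γ,
-- S = T ⊔ U; the Bool records the sign (true = minus) coming from the
-- anticommutation θ_T θ_U = ± θ_S.
Split : ℕ → Set
Split N = Vec ℕ N × Vec Bool N × Vec ℕ N × Vec Bool N × Bool

splits : ∀ {N} → Vec ℕ N → Vec Bool N → List (Split N)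
splits [] [] = ([] , [] , [] , [] , false) ∷ []
splits (a ∷ α) (s ∷ S) =
  concatMap (λ b →
    concatMap (λ tu →
      let t = Data.Product.proj₁ tu ; u = Data.Product.proj₂ tu in
      L.map (λ { (β , T , γ , U , neg) →
                 (b ∷ β , t ∷ T , (a ∸ b) ∷ γ , u ∷ U ,
                  neg xor (u ∧ odd (countTrue T))) })
            (splits α S))
      (if s then (true , false) ∷ (false , true) ∷ [] else (false , false) ∷ []))
    (upTo (suc a))

sumℚ : List ℚ → ℚ
sumℚ = foldr ℚ._+_ 0ℚ

_*sp_ : ∀ {N} → SP N → SP N → SP N
(f *sp g) (α , S) =
  sumℚ (L.map (λ { (β , T , γ , U , neg) → sign neg ℚ.* (f (β , T) ℚ.* g (γ , U)) })
              (splits α S))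

sumSP : ∀ {N} → List (SP N) → SP N
sumSP = foldr _+sp_ 0sp

-- Λ = (Λ₁,…,Λ_m ; Λ_{m+1},…): fermionic part (strictly decreasing, may
-- contain 0) and bosonic part (weakly decreasing); the bosonic part is
-- stored without its zero entries.
SPart : Set
SPart = List ℕ × List ℕ

strictParts : ℕ → ℕ → ℕ → List (List ℕ)
strictParts zero n b = if n ≡ᵇ 0 then [] ∷ [] else []
strictParts (suc m) n b =
  concatMap (λ p → L.map (p ∷_) (strictParts m (n ∸ p) p))
            (filter (λ p → p ℕ.≤? n) (upTo b))

-- partitions of n with positive parts ≤ k (fuel ≥ n suffices)
partsF : ℕ → ℕ → ℕ → List (List ℕ)
partsF zero n k = if n ≡ᵇ 0 then [] ∷ [] else []
partsF (suc fuel) n k =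
  if n ≡ᵇ 0 then [] ∷ [] else
  concatMap (λ p → L.map (suc p ∷_) (partsF fuel (n ∸ suc p) (suc p)))
            (filter (λ p → suc p ℕ.≤? n) (filter (λ p → suc p ℕ.≤? k) (upTo n)))

partitions : ℕ → List (List ℕ)
partitions n = partsF n n n

SPar : ℕ → ℕ → List SPart
SPar n m =
  concatMap (λ k → concatMap (λ a → L.map (λ s → (a , s)) (partitions (n ∸ k)))
                             (strictParts m k (suc n)))
            (upTo (suc n))

insertDesc : ℕ → List ℕ → List ℕ
insertDesc x [] = x ∷ []
insertDesc x (y ∷ ys) = if y ≤ᵇ x then x ∷ y ∷ ys else y ∷ insertDesc x ys

sortDesc : List ℕ → List ℕ
sortDesc = foldr insertDesc []

_==L_ : List ℕ → List ℕ → Bool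
xs ==L ys = does (≡-dec ℕ._≟_ xs ys)

fermExps : ∀ {N} → Vec ℕ N → Vec Bool N → List ℕ
fermExps [] [] = []
fermExps (a ∷ α) (s ∷ S) = if s then a ∷ fermExps α S else fermExps α S

bosExps : ∀ {N} → Vec ℕ N → Vec Bool N → List ℕ
bosExps [] [] = []
bosExps (a ∷ α) (s ∷ S) =
  if s ∨' (a ≡ᵇ 0) then bosExps α S else a ∷ bosExps α S
  where
  _∨'_ : Bool → Bool → Bool
  true ∨' _ = true
  false ∨' b = b

inversions : List ℕ → ℕ
inversions [] = 0
inversions (x ∷ xs) = L.length (filter (λ y → suc x ℕ.≤? y) xs) ℕ.+ inversions xs

-- m_Λ: the term θ_{i₁}⋯θ_{i_m} x_{i₁}^{Λ₁}⋯x_{i_m}^{Λ_m}⋯ (with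
-- Λ₁>⋯>Λ_m) equals (-1)^{inv} times the basis monomial with the θ's in
-- increasing index order, where inv counts the reorderings.
mono : ∀ {N} → SPart → SP N
mono (Λa , Λs) (α , S) =
  let f = fermExps α S in
  if (sortDesc f ==L Λa) ∧ (sortDesc (bosExps α S) ==L Λs)
  then sign (odd (inversions f)) else 0ℚ

fromℕ : ℕ → ℚ
fromℕ k = + k / 1

h : ∀ {N} → ℕ → SP N
h n = sumSP (L.map mono (SPar n 0))

ht : ∀ {N} → ℕ → SP N
ht n = sumSP (L.map (λ Λ → fromℕ (suc (firstPart Λ)) • mono Λ) (SPar n 1))
  where
  firstPart : SPart → ℕ
  firstPart ([] , _) = 0
  firstPart (a ∷ _ , _) = a

allLe1 : ∀ {N} → Vec ℕ N → Bool
allLe1 [] = true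
allLe1 (a ∷ α) = (a ≤ᵇ 1) ∧ allLe1 α

sumV : ∀ {N} → Vec ℕ N → ℕ
sumV [] = 0
sumV (a ∷ α) = a ℕ.+ sumV α

-- e_n = Σ_{j₁<⋯<j_n} x_{j₁}⋯x_{j_n}
e : ∀ {N} → ℕ → SP N
e n (α , S) = if noneTrue S ∧ allLe1 α ∧ (sumV α ≡ᵇ n) then 1ℚ else 0ℚ

oneFermAtZero : ∀ {N} → Vec ℕ N → Vec Bool N → Bool
oneFermAtZero [] [] = false
oneFermAtZero (a ∷ α) (true ∷ S) = (a ≡ᵇ 0) ∧ noneTrue S
oneFermAtZero (a ∷ α) (false ∷ S) = oneFermAtZero α S

-- ẽ_n = Σ_i θ_i Σ_{j₁<⋯<j_n, i ∉ {j_k}} x_{j₁}⋯x_{j_n}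
et : ∀ {N} → ℕ → SP N
et n (α , S) = if oneFermAtZero α S ∧ allLe1 α ∧ (sumV α ≡ᵇ n) then 1ℚ else 0ℚ

-- Determinant, expanded along the first row (entries of the first row
-- are multiplied on the left of the complementary minors)

Matrix : ℕ → ℕ → Set
Matrix N k = Fin k → Fin k → SP N

det : ∀ {N k} → Matrix N k → SP N
det {N} {zero} A = 1sp
det {N} {suc k} A =
  sumSP (L.map (λ j → sign (odd (toℕ j)) • (A F.zero j *sp det (λ r c → A (F.suc r) (punchIn j c))))
               (allFin (suc k)))

EMat : ∀ N n → Matrix N n
EMat N n i j = if toℕ i ≤ᵇ suc (toℕ j) then h (suc (toℕ j) ∸ toℕ i) else 0sp

-- (n+1)×(n+1) matrix: first row h̃_0,…,h̃_n; in 1-indexed row i ≥ 2,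
-- column j: (n+3-2i+j) h_{j-i+1} if j ≥ i-1, else 0.
-- With 0-indexed row r = i-1 ≥ 1, column c = j-1: (n+2-2r+c) h_{c-r+1}.
EtMat : ∀ N n → Matrix N (suc n)
EtMat N n F.zero c = ht (toℕ c)
EtMat N n (F.suc r') c =
  let r = suc (toℕ r') in
  if r ≤ᵇ suc (toℕ c)
  then fromℕ (n ℕ.+ 2 ℕ.+ toℕ c ∸ 2 ℕ.* r) • h (suc (toℕ c) ∸ r)
  else 0sp

invFact : ℕ → ℚ
invFact n = (+ 1 / (n !)) {{n !≢0}}

module Submission where

-- Both matrices are lower Hessenberg with scalar subdiagonal, so expanding along the first row
-- and recursing on the minors reduces the two formulas to convolution identities:
-- Σⱼ (-1)ʲ h_{j+1} e_{k-j} = e_{k+1} for the first; for the second, the minors of the ẽ-matrix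
-- are the m×m matrices B_m with det B_m = m! E²_m (E²_m := Σ_{a+b=m} e_a e_b, proved from
-- Σⱼ (-1)ʲ (k+2+j) h_{j+1} E²_{k-j} = (k+1) E²_{k+1}), and then Σⱼ (-1)ʲ h̃ⱼ E²_{n-j} = ẽ_n. Since h_n and h̃_n have the explicit
-- coefficients [S = ∅, |β| = n] and (βᵢ + 1)[S = {i}, |β| = n], the coefficient of θ_S x^α is a
-- sum over β ≤ α which factors into a product over the variables of one-variable alternating
-- sums, each a two- or three-term identity.

open import Defs
open import Data.Bool as B using (Bool; true; false; if_then_else_; _∧_; not; _xor_; T)
import Data.Bool.Properties as BP
open import Data.Nat as ℕ using (ℕ; zero; suc; _≤_; _!)
import Data.Nat.Properties as ℕP
open import Algebra.Properties.CommutativeSemigroup ℕP.+-commutativeSemigroup using (x∙yz≈y∙xz; interchange)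
open import Data.Nat.ListAction using (sum)
open import Data.List.Relation.Unary.All using (All; []; _∷_)
open import Data.List as L using (List; []; _∷_; _++_; concatMap; upTo; map; filter)
import Data.List.Properties as LP
open import Data.Vec as V using (Vec; []; _∷_)
open import Data.Fin as F using (Fin; toℕ; punchIn; punchOut)
import Data.Fin.Properties as FP
open import Data.Product using (_×_; _,_; proj₁; proj₂; Σ)
open import Data.Unit using (tt)
open import Data.Empty using (⊥-elim)
open import Relation.Binary.PropositionalEquality
open import Relation.Binary.Bundles using (Setoid)
open import Relation.Nullary using (Dec; does; ¬_; yes; no)
import Relation.Unary
open import Relation.Binary.Definitions using (Tri; tri<; tri≈; tri>)

[m+o]∸[n+o]≡m∸n : ∀ m n o → (m ℕ.+ o) ℕ.∸ (n ℕ.+ o) ≡ m ℕ.∸ n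
[m+o]∸[n+o]≡m∸n m n o =
  trans (cong₂ ℕ._∸_ (ℕP.+-comm m o) (ℕP.+-comm n o)) (ℕP.[m+n]∸[m+o]≡n∸o o m n)

[2+m]∸b≡3+[m∸1+b] : ∀ {b m} → b ℕ.< m → suc (suc m) ℕ.∸ b ≡ suc (suc (suc (m ℕ.∸ suc b)))
[2+m]∸b≡3+[m∸1+b] {zero} {suc m} _ = refl
[2+m]∸b≡3+[m∸1+b] {suc b} {suc m} (ℕ.s≤s b<m) = [2+m]∸b≡3+[m∸1+b] b<m

module _ where
  open import Data.Nat using (_+_; _*_; _∸_)
  open import Data.Nat.Solver using (module +-*-Solver)
  open +-*-Solver

  n+2+r∸2[1+r]≡n∸r : ∀ n r → n + 2 + r ∸ 2 * suc r ≡ n ∸ r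
  n+2+r∸2[1+r]≡n∸r n r = trans
    (cong₂ _∸_ (solve 2 (λ n r → n :+ con 2 :+ r := n :+ (con 2 :+ r)) refl n r)
               (solve 1 (λ r → con 2 :* (con 1 :+ r) := r :+ (con 2 :+ r)) refl r))
    ([m+o]∸[n+o]≡m∸n n r (2 + r))

  [1+k]+1+r∸2[1+r]≡k∸r : ∀ k r → suc k + 1 + r ∸ 2 * suc r ≡ k ∸ r
  [1+k]+1+r∸2[1+r]≡k∸r k r = trans
    (cong (_∸ 2 * suc r) (solve 2 (λ k r → con 1 :+ k :+ con 1 :+ r := k :+ con 2 :+ r) refl k r))
    (n+2+r∸2[1+r]≡n∸r k r)

  n+2+[c+1+j]∸2[r+1+j]≡[n∸j]+1+c∸2r : ∀ n j c r → j ℕ.≤ n →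
    n + 2 + (c + suc j) ∸ 2 * (r + suc j) ≡ (n ∸ j) + 1 + c ∸ 2 * r
  n+2+[c+1+j]∸2[r+1+j]≡[n∸j]+1+c∸2r n j c r j≤n = begin
    n + 2 + (c + suc j) ∸ 2 * (r + suc j)
      ≡⟨ cong (λ z → z + 2 + (c + suc j) ∸ 2 * (r + suc j)) (sym (ℕP.m∸n+n≡m j≤n)) ⟩
    (p + j) + 2 + (c + suc j) ∸ 2 * (r + suc j)
      ≡⟨ cong₂ _∸_ (solve 3 (λ p j c → (p :+ j) :+ con 2 :+ (c :+ (con 1 :+ j))
                                        := (p :+ con 1 :+ c) :+ (con 2 :+ con 2 :* j)) refl p j c)
                   (solve 2 (λ r j → con 2 :* (r :+ (con 1 :+ j)) := con 2 :* r :+ (con 2 :+ con 2 :* j)) refl r j) ⟩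
    (p + 1 + c) + (2 + 2 * j) ∸ (2 * r + (2 + 2 * j)) ≡⟨ [m+o]∸[n+o]≡m∸n (p + 1 + c) (2 * r) (2 + 2 * j) ⟩
    p + 1 + c ∸ 2 * r ∎
    where
    open ≡-Reasoning
    p = n ∸ j

  [1+k]+1+[c+1+t]∸2[r+1+t]≡[k∸t]+1+c∸2r : ∀ k t c r → t ℕ.≤ k →
    suc k + 1 + (c + suc t) ∸ 2 * (r + suc t) ≡ (k ∸ t) + 1 + c ∸ 2 * r
  [1+k]+1+[c+1+t]∸2[r+1+t]≡[k∸t]+1+c∸2r k t c r t≤k = trans
    (cong (_∸ 2 * (r + suc t)) (solve 2 (λ k x → con 1 :+ k :+ con 1 :+ x := k :+ con 2 :+ x) refl k (c + suc t)))
    (n+2+[c+1+j]∸2[r+1+j]≡[n∸j]+1+c∸2r k t c r t≤k)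

T→≡ : ∀ {b} → T b → b ≡ true
T→≡ {true} _ = refl

≡→T : ∀ {b} → b ≡ true → T b
≡→T refl = tt

<⇒<ᵇ≡true : ∀ {m n} → m ℕ.< n → (m ℕ.<ᵇ n) ≡ true
<⇒<ᵇ≡true p = T→≡ (ℕP.<⇒<ᵇ p)

≮⇒<ᵇ≡false : ∀ {m n} → ¬ (m ℕ.< n) → (m ℕ.<ᵇ n) ≡ false
≮⇒<ᵇ≡false {m} {n} np with m ℕ.<ᵇ n in eq
... | true = ⊥-elim (np (ℕP.<ᵇ⇒< m n (≡→T eq)))
... | false = refl

≤⇒≤ᵇ≡true : ∀ {m n} → m ℕ.≤ n → (m ℕ.≤ᵇ n) ≡ true
≤⇒≤ᵇ≡true p = T→≡ (ℕP.≤⇒≤ᵇ p)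

≰⇒≤ᵇ≡false : ∀ {m n} → ¬ (m ℕ.≤ n) → (m ℕ.≤ᵇ n) ≡ false
≰⇒≤ᵇ≡false {m} {n} np with m ℕ.≤ᵇ n in eq
... | true = ⊥-elim (np (ℕP.≤ᵇ⇒≤ m n (≡→T eq)))
... | false = refl

≡ᵇ-refl : ∀ n → (n ℕ.≡ᵇ n) ≡ true
≡ᵇ-refl n = T→≡ (ℕP.≡⇒≡ᵇ n n refl)

≢⇒≡ᵇ≡false : ∀ {m n} → m ≢ n → (m ℕ.≡ᵇ n) ≡ false
≢⇒≡ᵇ≡false {m} {n} np with m ℕ.≡ᵇ n in eq
... | true = ⊥-elim (np (ℕP.≡ᵇ⇒≡ m n (≡→T eq)))
... | false = refl

≡ᵇ≡true⇒≡ : ∀ {m n} → (m ℕ.≡ᵇ n) ≡ true → m ≡ n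
≡ᵇ≡true⇒≡ {m} {n} eq = ℕP.≡ᵇ⇒≡ m n (≡→T eq)

≡ᵇ≡false⇒≢ : ∀ {m n} → (m ℕ.≡ᵇ n) ≡ false → m ≢ n
≡ᵇ≡false⇒≢ {m} e refl with trans (sym (≡ᵇ-refl m)) e
... | ()

+≡ᵇ-shift : ∀ x s n → x ℕ.≤ n → (x ℕ.+ s ℕ.≡ᵇ n) ≡ (s ℕ.≡ᵇ n ℕ.∸ x)
+≡ᵇ-shift zero s n _ = refl
+≡ᵇ-shift (suc x) s (suc n) (ℕ.s≤s p) = +≡ᵇ-shift x s n p

+≡ᵇ-over : ∀ x s n → n ℕ.< x → (x ℕ.+ s ℕ.≡ᵇ n) ≡ false
+≡ᵇ-over (suc x) s zero _ = refl
+≡ᵇ-over (suc x) s (suc n) (ℕ.s≤s p) = +≡ᵇ-over x s n p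

<ᵇ-suc : ∀ m n → (m ℕ.<ᵇ suc n) ≡ (m ℕ.≤ᵇ n)
<ᵇ-suc zero n = refl
<ᵇ-suc (suc m) n = refl

≤ᵇ-+ʳ : ∀ m n o → (m ℕ.+ o ℕ.≤ᵇ n ℕ.+ o) ≡ (m ℕ.≤ᵇ n)
≤ᵇ-+ʳ m n zero = cong₂ ℕ._≤ᵇ_ (ℕP.+-identityʳ m) (ℕP.+-identityʳ n)
≤ᵇ-+ʳ m n (suc o) rewrite ℕP.+-suc m o | ℕP.+-suc n o = trans (<ᵇ-suc (m ℕ.+ o) (n ℕ.+ o)) (≤ᵇ-+ʳ m n o)

import Data.Integer as ℤ
import Data.Integer.Properties as ℤP
open import Data.Rational as ℚ using (ℚ; 0ℚ; 1ℚ; mkℚ; _+_; _*_; -_)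
import Data.Rational.Properties as ℚP
import Data.Nat.Coprimality as C
open import Data.Rational.Solver
open +-*-Solver

fromℕ≡mkℚ : ∀ k → fromℕ k ≡ mkℚ (ℤ.+ k) 0 (C.sym (C.1-coprimeTo k))
fromℕ≡mkℚ k = ℚP.normalize-coprime (C.sym (C.1-coprimeTo k))

fromℕ-suc : ∀ k → fromℕ (suc k) ≡ 1ℚ + fromℕ k
fromℕ-suc k = sym (trans (cong (1ℚ +_) (fromℕ≡mkℚ k))
   (cong (λ z → (ℤ.+ 1 ℤ.+ z) ℚ./ 1) (trans (ℤP.+◃n≡+n (k ℕ.* 1)) (cong ℤ.+_ (ℕP.*-identityʳ k)))))

fromℕ-+ : ∀ a b → fromℕ (a ℕ.+ b) ≡ fromℕ a + fromℕ b
fromℕ-+ zero b = sym (ℚP.+-identityˡ (fromℕ b))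
fromℕ-+ (suc a) b = begin
  fromℕ (suc (a ℕ.+ b)) ≡⟨ fromℕ-suc (a ℕ.+ b) ⟩
  1ℚ + fromℕ (a ℕ.+ b) ≡⟨ cong (1ℚ +_) (fromℕ-+ a b) ⟩
  1ℚ + (fromℕ a + fromℕ b) ≡⟨ sym (ℚP.+-assoc 1ℚ (fromℕ a) (fromℕ b)) ⟩
  (1ℚ + fromℕ a) + fromℕ b ≡⟨ cong (_+ fromℕ b) (sym (fromℕ-suc a)) ⟩
  fromℕ (suc a) + fromℕ b ∎
  where open ≡-Reasoning

fromℕ-* : ∀ a b → fromℕ (a ℕ.* b) ≡ fromℕ a * fromℕ b
fromℕ-* zero b = sym (ℚP.*-zeroˡ (fromℕ b))
fromℕ-* (suc a) b = begin
  fromℕ (b ℕ.+ a ℕ.* b) ≡⟨ fromℕ-+ b (a ℕ.* b) ⟩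
  fromℕ b + fromℕ (a ℕ.* b) ≡⟨ cong (fromℕ b +_) (fromℕ-* a b) ⟩
  fromℕ b + fromℕ a * fromℕ b ≡⟨ solve 2 (λ x y → y :+ x :* y := (con 1ℚ :+ x) :* y) refl (fromℕ a) (fromℕ b) ⟩
  (1ℚ + fromℕ a) * fromℕ b ≡⟨ cong (_* fromℕ b) (sym (fromℕ-suc a)) ⟩
  fromℕ (suc a) * fromℕ b ∎
  where open ≡-Reasoning

fromℕ-2 : fromℕ 2 ≡ 1ℚ + 1ℚ
fromℕ-2 = fromℕ-suc 1

fromℕ-2+ : ∀ m → fromℕ (suc (suc m)) ≡ 1ℚ + (1ℚ + fromℕ m)
fromℕ-2+ m = trans (fromℕ-suc (suc m)) (cong (1ℚ +_) (fromℕ-suc m))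

sgn : ℕ → ℚ
sgn n = sign (odd n)

sign-not : ∀ b → sign (not b) ≡ - sign b
sign-not true = refl
sign-not false = refl

sgn-suc : ∀ n → sgn (suc n) ≡ - sgn n
sgn-suc n = sign-not (odd n)

sgn-suc-suc : ∀ n → sgn (suc (suc n)) ≡ sgn n
sgn-suc-suc n = cong sign (BP.not-involutive (odd n))

sign-xor : ∀ x y → sign (x xor y) ≡ sign x * sign y
sign-xor true true = refl
sign-xor true false = refl
sign-xor false y = sym (ℚP.*-identityˡ (sign y))

odd-+ : ∀ a b → odd (a ℕ.+ b) ≡ odd a xor odd b
odd-+ zero b = refl
odd-+ (suc a) b = trans (cong not (odd-+ a b)) (BP.not-distribˡ-xor (odd a) (odd b))

sgn-+ : ∀ a b → sgn (a ℕ.+ b) ≡ sgn a * sgn b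
sgn-+ a b = trans (cong sign (odd-+ a b)) (sign-xor (odd a) (odd b))

𝟙 : Bool → ℚ
𝟙 b = if b then 1ℚ else 0ℚ

𝟙-∧ : ∀ x y → 𝟙 (x ∧ y) ≡ 𝟙 x * 𝟙 y
𝟙-∧ true y = sym (ℚP.*-identityˡ (𝟙 y))
𝟙-∧ false y = sym (ℚP.*-zeroˡ (𝟙 y))

∑ : ∀ {a} {A : Set a} → List A → (A → ℚ) → ℚ
∑ xs f = sumℚ (map f xs)

∑-++ : ∀ {a} {A : Set a} (xs ys : List A) f → ∑ (xs ++ ys) f ≡ ∑ xs f + ∑ ys f
∑-++ [] ys f = sym (ℚP.+-identityˡ _)
∑-++ (x ∷ xs) ys f = trans (cong (f x +_) (∑-++ xs ys f)) (sym (ℚP.+-assoc (f x) _ _))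

∑-cong : ∀ {a} {A : Set a} (xs : List A) {f g} → (∀ x → f x ≡ g x) → ∑ xs f ≡ ∑ xs g
∑-cong [] eq = refl
∑-cong (x ∷ xs) eq = cong₂ _+_ (eq x) (∑-cong xs eq)

∑-map : ∀ {a b} {A : Set a} {B : Set b} (xs : List A) (g : A → B) f → ∑ (map g xs) f ≡ ∑ xs (λ x → f (g x))
∑-map [] g f = refl
∑-map (x ∷ xs) g f = cong (f (g x) +_) (∑-map xs g f)

∑-concatMap : ∀ {a b} {A : Set a} {B : Set b} (xs : List A) (g : A → List B) f →
  ∑ (concatMap g xs) f ≡ ∑ xs (λ x → ∑ (g x) f)
∑-concatMap [] g f = refl
∑-concatMap (x ∷ xs) g f = trans (∑-++ (g x) (concatMap g xs) f) (cong (∑ (g x) f +_) (∑-concatMap xs g f))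

∑-zero : ∀ {a} {A : Set a} (xs : List A) → ∑ xs (λ _ → 0ℚ) ≡ 0ℚ
∑-zero [] = refl
∑-zero (x ∷ xs) = trans (ℚP.+-identityˡ _) (∑-zero xs)

∑-vanishes : ∀ {a} {A : Set a} (xs : List A) {f} → (∀ x → f x ≡ 0ℚ) → ∑ xs f ≡ 0ℚ
∑-vanishes xs eq = trans (∑-cong xs eq) (∑-zero xs)

∑-+ : ∀ {a} {A : Set a} (xs : List A) f g → ∑ xs (λ x → f x + g x) ≡ ∑ xs f + ∑ xs g
∑-+ [] f g = refl
∑-+ (x ∷ xs) f g = trans (cong (f x + g x +_) (∑-+ xs f g))
  (solve 4 (λ a b c d → (a :+ b) :+ (c :+ d) := (a :+ c) :+ (b :+ d)) refl (f x) (g x) (∑ xs f) (∑ xs g))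

∑-*ˡ : ∀ {a} {A : Set a} (xs : List A) c f → ∑ xs (λ x → c * f x) ≡ c * ∑ xs f
∑-*ˡ [] c f = sym (ℚP.*-zeroʳ c)
∑-*ˡ (x ∷ xs) c f = trans (cong (c * f x +_) (∑-*ˡ xs c f)) (sym (ℚP.*-distribˡ-+ c (f x) _))

∑-*ʳ : ∀ {a} {A : Set a} (xs : List A) c f → ∑ xs (λ x → f x * c) ≡ ∑ xs f * c
∑-*ʳ xs c f = trans (∑-cong xs (λ x → ℚP.*-comm (f x) c)) (trans (∑-*ˡ xs c f) (ℚP.*-comm c _))

∑-swap : ∀ {a b} {A : Set a} {B : Set b} (xs : List A) (ys : List B) (f : A → B → ℚ) →
  ∑ xs (λ x → ∑ ys (λ y → f x y)) ≡ ∑ ys (λ y → ∑ xs (λ x → f x y))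
∑-swap [] ys f = sym (∑-zero ys)
∑-swap (x ∷ xs) ys f = trans (cong (∑ ys (f x) +_) (∑-swap xs ys f)) (sym (∑-+ ys (f x) (λ y → ∑ xs (λ x' → f x' y))))

∑∑-vanishes : ∀ {a b} {A : Set a} {B : Set b} (xs : List A) (ys : List B) (w : B → ℚ) (f g : A → B → ℚ) →
  (∀ x y → f x y ≡ 0ℚ) → ∑ xs (λ x → ∑ ys (λ y → w y * (f x y * g x y))) ≡ 0ℚ
∑∑-vanishes xs ys w f g z = ∑-vanishes xs (λ x → ∑-vanishes ys (λ y →
  trans (cong (λ u → w y * (u * g x y)) (z x y)) (trans (cong (w y *_) (ℚP.*-zeroˡ (g x y))) (ℚP.*-zeroʳ (w y)))))

∑-filter : ∀ {a p} {A : Set a} {P : A → Set p} (P? : Relation.Unary.Decidable P) (xs : List A) f →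
  ∑ (filter P? xs) f ≡ ∑ xs (λ x → if does (P? x) then f x else 0ℚ)
∑-filter P? [] f = refl
∑-filter P? (x ∷ xs) f with does (P? x)
... | true = cong (f x +_) (∑-filter P? xs f)
... | false = trans (∑-filter P? xs f) (sym (ℚP.+-identityˡ _))

∑-neg : ∀ {a} {A : Set a} (xs : List A) f → ∑ xs (λ x → - f x) ≡ - ∑ xs f
∑-neg [] f = refl
∑-neg (x ∷ xs) f = trans (cong (- f x +_) (∑-neg xs f)) (sym (ℚP.neg-distrib-+ (f x) (∑ xs f)))

∑-applyUpTo-suc-vanishes : ∀ n (g : ℕ → ℕ) (F : ℕ → ℚ) → (∀ x → F (suc x) ≡ 0ℚ) →
  ∑ (L.applyUpTo (λ x → suc (g x)) n) F ≡ 0ℚ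
∑-applyUpTo-suc-vanishes zero g F z = refl
∑-applyUpTo-suc-vanishes (suc n) g F z =
  trans (cong (_+ rest) (z (g 0))) (trans (ℚP.+-identityˡ rest) (∑-applyUpTo-suc-vanishes n (λ x → g (suc x)) F z))
  where rest = ∑ (L.applyUpTo (λ x → suc (g (suc x))) n) F

∑-upTo-snoc : ∀ n (φ : ℕ → ℚ) → ∑ (upTo (suc n)) φ ≡ ∑ (upTo n) φ + φ n
∑-upTo-snoc n φ = trans (cong (λ l → ∑ l φ) (sym (LP.upTo-∷ʳ n)))
  (trans (∑-++ (upTo n) (n ∷ []) φ) (cong (∑ (upTo n) φ +_) (ℚP.+-identityʳ (φ n))))

∑-cong-upTo : ∀ n {f g : ℕ → ℚ} → (∀ b → b ℕ.< n → f b ≡ g b) → ∑ (upTo n) f ≡ ∑ (upTo n) g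
∑-cong-upTo zero eq = refl
∑-cong-upTo (suc n) {f} {g} eq = begin
  ∑ (upTo (suc n)) f ≡⟨ ∑-upTo-snoc n f ⟩
  ∑ (upTo n) f + f n ≡⟨ cong₂ _+_ (∑-cong-upTo n (λ b p → eq b (ℕP.m<n⇒m<1+n p))) (eq n (ℕP.n<1+n n)) ⟩
  ∑ (upTo n) g + g n ≡⟨ sym (∑-upTo-snoc n g) ⟩
  ∑ (upTo (suc n)) g ∎
  where open ≡-Reasoning

∑-upTo-delta : ∀ n x (G : ℕ → ℚ) → ∑ (upTo n) (λ p → if x ℕ.≡ᵇ p then G p else 0ℚ) ≡ (if x ℕ.<ᵇ n then G x else 0ℚ)
∑-upTo-delta zero x G = refl
∑-upTo-delta (suc n) x G = begin
  ∑ (upTo (suc n)) F ≡⟨ ∑-upTo-snoc n F ⟩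
  ∑ (upTo n) F + F n ≡⟨ cong (_+ F n) (∑-upTo-delta n x G) ⟩
  (if x ℕ.<ᵇ n then G x else 0ℚ) + F n ≡⟨ last (ℕP.<-cmp x n) ⟩
  (if x ℕ.<ᵇ suc n then G x else 0ℚ) ∎
  where
  open ≡-Reasoning
  F = λ p → if x ℕ.≡ᵇ p then G p else 0ℚ
  last : Tri (x ℕ.< n) (x ≡ n) (n ℕ.< x) → (if x ℕ.<ᵇ n then G x else 0ℚ) + F n ≡ (if x ℕ.<ᵇ suc n then G x else 0ℚ)
  last (tri< x<n x≢n _) rewrite <⇒<ᵇ≡true x<n | ≢⇒≡ᵇ≡false x≢n | <⇒<ᵇ≡true (ℕP.m<n⇒m<1+n x<n) = ℚP.+-identityʳ (G x)
  last (tri≈ _ refl _) rewrite ≮⇒<ᵇ≡false (ℕP.<-irrefl {x} refl) | ≡ᵇ-refl x | <⇒<ᵇ≡true (ℕP.n<1+n x) = ℚP.+-identityˡ (G x)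
  last (tri> x≮n x≢n _) rewrite ≮⇒<ᵇ≡false x≮n | ≢⇒≡ᵇ≡false x≢n
    | ≮⇒<ᵇ≡false (λ p → x≮n (ℕP.≤∧≢⇒< (ℕP.≤-pred p) x≢n)) = refl

∑-upTo-last3 : ∀ m (φ : ℕ → ℚ) → (∀ b → b ℕ.< m → φ b ≡ 0ℚ) → ∑ (upTo (suc (suc (suc m)))) φ ≡ φ m + (φ (suc m) + φ (suc (suc m)))
∑-upTo-last3 m φ z = begin
  ∑ (upTo (suc (suc (suc m)))) φ ≡⟨ ∑-upTo-snoc (suc (suc m)) φ ⟩
  ∑ (upTo (suc (suc m))) φ + φ (suc (suc m)) ≡⟨ cong (_+ φ (suc (suc m))) (∑-upTo-snoc (suc m) φ) ⟩
  (∑ (upTo (suc m)) φ + φ (suc m)) + φ (suc (suc m)) ≡⟨ cong (λ z → (z + φ (suc m)) + φ (suc (suc m))) (∑-upTo-snoc m φ) ⟩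
  ((∑ (upTo m) φ + φ m) + φ (suc m)) + φ (suc (suc m))
    ≡⟨ cong (λ z → ((z + φ m) + φ (suc m)) + φ (suc (suc m))) (trans (∑-cong-upTo m z) (∑-zero (upTo m))) ⟩
  ((0ℚ + φ m) + φ (suc m)) + φ (suc (suc m))
    ≡⟨ solve 3 (λ x y w → ((con 0ℚ :+ x) :+ y) :+ w := x :+ (y :+ w)) refl (φ m) (φ (suc m)) (φ (suc (suc m))) ⟩
  φ m + (φ (suc m) + φ (suc (suc m))) ∎
  where open ≡-Reasoning

∑-tabulate-vanishes : ∀ {a} {A : Set a} {n} (f : Fin n → A) (g : A → ℚ) → (∀ i → g (f i) ≡ 0ℚ) → ∑ (L.tabulate f) g ≡ 0ℚ
∑-tabulate-vanishes {n = zero} f g z = refl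
∑-tabulate-vanishes {n = suc n} f g z =
  trans (cong₂ _+_ (z F.zero) (∑-tabulate-vanishes (λ i → f (F.suc i)) g (λ i → z (F.suc i)))) (ℚP.+-identityˡ 0ℚ)

∑-tabulate-upTo : ∀ {a} {A : Set a} n (f : Fin n → A) (g : A → ℚ) (h : ℕ → ℕ) (g' : ℕ → ℚ) →
  (∀ i → g (f i) ≡ g' (h (toℕ i))) → ∑ (L.tabulate f) g ≡ ∑ (L.applyUpTo h n) g'
∑-tabulate-upTo zero f g h g' eq = refl
∑-tabulate-upTo (suc n) f g h g' eq = cong₂ _+_ (eq F.zero) (∑-tabulate-upTo n (λ i → f (F.suc i)) g (λ x → h (suc x)) g' (λ i → eq (F.suc i)))

below : ∀ {N} → Vec ℕ N → List (Vec ℕ N)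
below [] = [] ∷ []
below (a ∷ α) = concatMap (λ b → map (b ∷_) (below α)) (upTo (suc a))

vsub : ∀ {N} → Vec ℕ N → Vec ℕ N → Vec ℕ N
vsub [] [] = []
vsub (a ∷ α) (b ∷ β) = (a ℕ.∸ b) ∷ vsub α β

allFalse : ∀ {N} → Vec Bool N
allFalse {zero} = []
allFalse {suc N} = false ∷ allFalse

Bosonic : ∀ {N} → SP N → Set
Bosonic f = ∀ α S → T (not (noneTrue S)) → f (α , S) ≡ 0ℚ

splitTerm : ∀ {N} → SP N → SP N → Split N → ℚ
splitTerm f g (β , T , γ , U , neg) = sign neg * (f (β , T) * g (γ , U))

∑-below-∷ : ∀ {N} a (α : Vec ℕ N) (F : Vec ℕ (suc N) → ℚ) →
  ∑ (below (a ∷ α)) F ≡ ∑ (upTo (suc a)) (λ b → ∑ (below α) (λ β → F (b ∷ β)))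
∑-below-∷ a α F = trans (∑-concatMap (upTo (suc a)) (λ b → map (b ∷_) (below α)) F) (∑-cong (upTo (suc a)) (λ b → ∑-map (below α) (b ∷_) F))

-- Coordinatewise, a split giving this variable's θ to the bosonic right factor contributes 0,
-- and the remaining split carries no sign.
*sp-bosonicʳ : ∀ {N} (f g : SP N) → Bosonic g → ∀ α S →
  (f *sp g) (α , S) ≡ ∑ (below α) (λ β → f (β , S) * g (vsub α β , allFalse))
*sp-bosonicʳ f g ev [] [] = cong (_+ 0ℚ) (ℚP.*-identityˡ (f ([] , []) * g ([] , [])))
*sp-bosonicʳ {suc N} f g ev (a ∷ α) (s ∷ S) = begin
  ∑ (splits (a ∷ α) (s ∷ S)) (splitTerm f g)
    ≡⟨ ∑-concatMap (upTo (suc a)) (λ b → concatMap (λ tu → map (extend b tu) (splits α S)) (θsplits s)) (splitTerm f g) ⟩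
  ∑ (upTo (suc a)) (λ b → ∑ (concatMap (λ tu → map (extend b tu) (splits α S)) (θsplits s)) (splitTerm f g))
    ≡⟨ ∑-cong (upTo (suc a)) (λ b → coordinate b s) ⟩
  ∑ (upTo (suc a)) (λ b → ∑ (below α) (λ β → f (b ∷ β , s ∷ S) * g ((a ℕ.∸ b) ∷ vsub α β , false ∷ allFalse)))
    ≡⟨ sym (∑-below-∷ a α (λ β → f (β , s ∷ S) * g (vsub (a ∷ α) β , allFalse))) ⟩
  ∑ (below (a ∷ α)) (λ β → f (β , s ∷ S) * g (vsub (a ∷ α) β , allFalse)) ∎
  where
  open ≡-Reasoning
  θsplits : Bool → List (Bool × Bool)
  θsplits s = if s then (true , false) ∷ (false , true) ∷ [] else (false , false) ∷ []
  extend : ℕ → Bool × Bool → Split N → Split (suc N)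
  extend b tu = λ { (β , T , γ , U , neg) → (b ∷ β , proj₁ tu ∷ T , (a ℕ.∸ b) ∷ γ , proj₂ tu ∷ U ,
                  neg xor (proj₂ tu ∧ odd (countTrue T))) }
  f′ : ℕ → Bool → SP N
  f′ b t (β , T) = f (b ∷ β , t ∷ T)
  g′ : ℕ → SP N
  g′ b (γ , U) = g ((a ℕ.∸ b) ∷ γ , false ∷ U)
  g′-bosonic : ∀ b → Bosonic (g′ b)
  g′-bosonic b γ U p = ev _ _ p
  θ-on-left : ∀ b t → ∑ (map (extend b (t , false)) (splits α S)) (splitTerm f g) ≡ ∑ (splits α S) (splitTerm (f′ b t) (g′ b))
  θ-on-left b t = trans (∑-map (splits α S) (extend b (t , false)) (splitTerm f g))
     (∑-cong (splits α S) (λ { (β , T , γ , U , neg) → cong (λ z → sign z * (f (b ∷ β , t ∷ T) * g ((a ℕ.∸ b) ∷ γ , false ∷ U))) (BP.xor-identityʳ neg) }))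
  θ-on-right : ∀ b → ∑ (map (extend b (false , true)) (splits α S)) (splitTerm f g) ≡ 0ℚ
  θ-on-right b = trans (∑-map (splits α S) (extend b (false , true)) (splitTerm f g))
     (∑-vanishes (splits α S) (λ { (β , T , γ , U , neg) →
        let sg = sign (neg xor (true ∧ odd (countTrue T))) ; fv = f (b ∷ β , false ∷ T) in
        trans (cong (λ z → sg * (fv * z)) (ev ((a ℕ.∸ b) ∷ γ) (true ∷ U) tt)) (trans (cong (sg *_) (ℚP.*-zeroʳ fv)) (ℚP.*-zeroʳ sg)) }))
  coordinate : ∀ b s → ∑ (concatMap (λ tu → map (extend b tu) (splits α S)) (θsplits s)) (splitTerm f g)
               ≡ ∑ (below α) (λ β → f (b ∷ β , s ∷ S) * g ((a ℕ.∸ b) ∷ vsub α β , false ∷ allFalse))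
  coordinate b false = trans (∑-concatMap (θsplits false) (λ tu → map (extend b tu) (splits α S)) (splitTerm f g))
    (trans (ℚP.+-identityʳ (∑ (map (extend b (false , false)) (splits α S)) (splitTerm f g)))
    (trans (θ-on-left b false) (*sp-bosonicʳ (f′ b false) (g′ b) (g′-bosonic b) α S)))
  coordinate b true = trans (∑-concatMap (θsplits true) (λ tu → map (extend b tu) (splits α S)) (splitTerm f g)) (begin
    ∑ (map (extend b (true , false)) (splits α S)) (splitTerm f g) + (∑ (map (extend b (false , true)) (splits α S)) (splitTerm f g) + 0ℚ)
      ≡⟨ cong₂ _+_ (θ-on-left b true) (trans (ℚP.+-identityʳ (∑ (map (extend b (false , true)) (splits α S)) (splitTerm f g))) (θ-on-right b)) ⟩
    ∑ (splits α S) (splitTerm (f′ b true) (g′ b)) + 0ℚ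
      ≡⟨ trans (ℚP.+-identityʳ (∑ (splits α S) (splitTerm (f′ b true) (g′ b)))) (*sp-bosonicʳ (f′ b true) (g′ b) (g′-bosonic b) α S) ⟩
    ∑ (below α) (λ β → f (b ∷ β , true ∷ S) * g ((a ℕ.∸ b) ∷ vsub α β , false ∷ allFalse)) ∎)

sumSP-apply : ∀ {N} (fs : List (SP N)) μ → sumSP fs μ ≡ sumℚ (map (λ f → f μ) fs)
sumSP-apply [] μ = refl
sumSP-apply (f ∷ fs) μ = cong (f μ +_) (sumSP-apply fs μ)

sumSP-map : ∀ {a} {A : Set a} {N} (xs : List A) (F : A → SP N) μ → sumSP (map F xs) μ ≡ ∑ xs (λ x → F x μ)
sumSP-map xs F μ = trans (sumSP-apply (map F xs) μ) (∑-map xs F (λ f → f μ))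

sumSP-cong : ∀ {a} {A : Set a} {N} (xs : List A) (F G : A → SP N) → (∀ x → F x ≋ G x) → sumSP (map F xs) ≋ sumSP (map G xs)
sumSP-cong xs F G eq μ = trans (sumSP-map xs F μ) (trans (∑-cong xs (λ x → eq x μ)) (sym (sumSP-map xs G μ)))

*sp-cong : ∀ {N} {f f' g g' : SP N} → f ≋ f' → g ≋ g' → (f *sp g) ≋ (f' *sp g')
*sp-cong {f = f} {f'} {g} {g'} ef eg (α , S) = ∑-cong (splits α S)
  (λ { (β , T , γ , U , neg) → cong₂ (λ x y → sign neg * (x * y)) (ef (β , T)) (eg (γ , U)) })

•-cong : ∀ {N} q {f g : SP N} → f ≋ g → (q • f) ≋ (q • g)
•-cong q eq μ = cong (q *_) (eq μ)

*sp-zeroˡ : ∀ {N} {f : SP N} (g : SP N) → (∀ μ → f μ ≡ 0ℚ) → (f *sp g) ≋ 0sp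
*sp-zeroˡ {f = f} g z (α , S) = ∑-vanishes (splits α S)
  (λ { (β , T , γ , U , neg) → trans (cong (λ x → sign neg * (x * g (γ , U))) (z (β , T)))
        (trans (cong (sign neg *_) (ℚP.*-zeroˡ (g (γ , U)))) (ℚP.*-zeroʳ (sign neg))) })

*sp-zeroʳ : ∀ {N} (f : SP N) {g : SP N} → (∀ μ → g μ ≡ 0ℚ) → (f *sp g) ≋ 0sp
*sp-zeroʳ f {g} z (α , S) = ∑-vanishes (splits α S)
  (λ { (β , T , γ , U , neg) → trans (cong (λ x → sign neg * (f (β , T) * x)) (z (γ , U)))
        (trans (cong (sign neg *_) (ℚP.*-zeroʳ (f (β , T)))) (ℚP.*-zeroʳ (sign neg))) })

*sp-•ˡ : ∀ {N} q (f g : SP N) → ((q • f) *sp g) ≋ (q • (f *sp g))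
*sp-•ˡ q f g (α , S) = trans (∑-cong (splits α S)
  (λ { (β , T , γ , U , neg) → solve 4 (λ s q x y → s :* ((q :* x) :* y) := q :* (s :* (x :* y))) refl
        (sign neg) q (f (β , T)) (g (γ , U)) }))
  (∑-*ˡ (splits α S) q (splitTerm f g))

*sp-•ʳ : ∀ {N} q (f g : SP N) → (f *sp (q • g)) ≋ (q • (f *sp g))
*sp-•ʳ q f g (α , S) = trans (∑-cong (splits α S)
  (λ { (β , T , γ , U , neg) → solve 4 (λ s q x y → s :* (x :* (q :* y)) := q :* (s :* (x :* y))) refl
        (sign neg) q (f (β , T)) (g (γ , U)) }))
  (∑-*ˡ (splits α S) q (splitTerm f g))

•-assoc : ∀ {N} p q (f : SP N) → (p • (q • f)) ≋ ((p * q) • f)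
•-assoc p q f μ = sym (ℚP.*-assoc p q (f μ))

•-sumSP : ∀ {a} {A : Set a} {N} q (xs : List A) (F : A → SP N) → (q • sumSP (map F xs)) ≋ sumSP (map (λ x → q • F x) xs)
•-sumSP q xs F μ = trans (cong (q *_) (sumSP-map xs F μ)) (trans (sym (∑-*ˡ xs q (λ x → F x μ))) (sym (sumSP-map xs (λ x → q • F x) μ)))

≋-trans : ∀ {N} {f g h : SP N} → f ≋ g → g ≋ h → f ≋ h
≋-trans a b μ = trans (a μ) (b μ)

≋-sym : ∀ {N} {f g : SP N} → f ≋ g → g ≋ f
≋-sym a μ = sym (a μ)

≋-refl : ∀ {N} {f : SP N} → f ≋ f
≋-refl μ = refl

≋-setoid : ℕ → Setoid _ _
≋-setoid N = record { Carrier = SP N ; _≈_ = _≋_ ; isEquivalence = record { refl = λ {f} → ≋-refl {f = f} ; sym = ≋-sym ; trans = ≋-trans } }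

•-identityˡ : ∀ {N} (X : SP N) → (1ℚ • X) ≋ X
•-identityˡ X μ = ℚP.*-identityˡ (X μ)

sumSP-cong-upTo : ∀ {N} n (F G : ℕ → SP N) → (∀ j → j ℕ.< n → F j ≋ G j) → sumSP (map F (upTo n)) ≋ sumSP (map G (upTo n))
sumSP-cong-upTo n F G eq μ = trans (sumSP-map (upTo n) F μ) (trans (∑-cong-upTo n (λ j p → eq j p μ)) (sym (sumSP-map (upTo n) G μ)))

IsZero : ∀ {N} → SP N → Set
IsZero f = ∀ μ → f μ ≡ 0ℚ

bosonic-0 : ∀ {N} → Bosonic {N} 0sp
bosonic-0 α S p = refl

bosonic-• : ∀ {N} q {f : SP N} → Bosonic f → Bosonic (q • f)
bosonic-• q ev α S p = trans (cong (q *_) (ev α S p)) (ℚP.*-zeroʳ q)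

bosonic-sumSP : ∀ {a} {A : Set a} {N} (xs : List A) (F : A → SP N) → (∀ x → Bosonic (F x)) → Bosonic (sumSP (map F xs))
bosonic-sumSP xs F ev α S p = trans (sumSP-map xs F (α , S)) (∑-vanishes xs (λ x → ev x α S p))

bosonic-* : ∀ {N} {f g : SP N} → Bosonic f → Bosonic g → Bosonic (f *sp g)
bosonic-* {f = f} {g} ef eg α S p = trans (*sp-bosonicʳ f g eg α S)
  (∑-vanishes (below α) (λ β → trans (cong (_* g (vsub α β , allFalse)) (ef β S p)) (ℚP.*-zeroˡ (g (vsub α β , allFalse)))))

bosonic-1 : ∀ {N} → Bosonic {N} 1sp
bosonic-1 α S p with noneTrue S
bosonic-1 α S () | true
... | false = cong 𝟙 (BP.∧-zeroʳ (allZero α))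

bosonic-if : ∀ {N} (b : Bool) (f : SP N) → Bosonic f → Bosonic (if b then f else 0sp)
bosonic-if true f ev = ev
bosonic-if false f ev = bosonic-0

zeros : ∀ {N} → Vec ℕ N
zeros {zero} = []
zeros {suc N} = 0 ∷ zeros

∑-below-delta-zeros : ∀ {N} (α : Vec ℕ N) (G : Vec ℕ N → ℚ) → ∑ (below α) (λ β → if allZero β then G β else 0ℚ) ≡ G zeros
∑-below-delta-zeros [] G = ℚP.+-identityʳ (G [])
∑-below-delta-zeros (a ∷ α) G = begin
  ∑ (below (a ∷ α)) (λ β → if allZero β then G β else 0ℚ) ≡⟨ ∑-below-∷ a α _ ⟩
  ∑ (upTo (suc a)) (λ b → ∑ (below α) (λ β → if (b ℕ.≡ᵇ 0) ∧ allZero β then G (b ∷ β) else 0ℚ)) ≡⟨⟩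
  ∑ (below α) (λ β → if allZero β then G (0 ∷ β) else 0ℚ) + ∑ (L.applyUpTo (λ x → suc x) a) (λ b → ∑ (below α) (λ β → if (b ℕ.≡ᵇ 0) ∧ allZero β then G (b ∷ β) else 0ℚ))
    ≡⟨ cong₂ _+_ (∑-below-delta-zeros α (λ β → G (0 ∷ β))) (∑-applyUpTo-suc-vanishes a (λ x → x) _ (λ x → ∑-zero (below α))) ⟩
  G (0 ∷ zeros) + 0ℚ ≡⟨ ℚP.+-identityʳ _ ⟩
  G zeros ∎
  where open ≡-Reasoning

vsub-zeros : ∀ {N} (α : Vec ℕ N) → vsub α zeros ≡ α
vsub-zeros [] = refl
vsub-zeros (a ∷ α) = cong (a ∷_) (vsub-zeros α)

noneTrue⇒allFalse : ∀ {N} (S : Vec Bool N) → noneTrue S ≡ true → S ≡ allFalse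
noneTrue⇒allFalse [] p = refl
noneTrue⇒allFalse (false ∷ S) p = cong (false ∷_) (noneTrue⇒allFalse S p)
noneTrue⇒allFalse (true ∷ S) ()

*sp-identityˡ : ∀ {N} (X : SP N) → Bosonic X → (1sp *sp X) ≋ X
*sp-identityˡ X ev (α , S) with noneTrue S in eq
... | true = begin
  (1sp *sp X) (α , S) ≡⟨ *sp-bosonicʳ 1sp X ev α S ⟩
  ∑ (below α) (λ β → (if allZero β ∧ noneTrue S then 1ℚ else 0ℚ) * X (vsub α β , allFalse))
    ≡⟨ ∑-cong (below α) (λ β → lem (allZero β) _) ⟩
  ∑ (below α) (λ β → if allZero β then X (vsub α β , allFalse) else 0ℚ) ≡⟨ ∑-below-delta-zeros α (λ β → X (vsub α β , allFalse)) ⟩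
  X (vsub α zeros , allFalse) ≡⟨ cong₂ (λ a b → X (a , b)) (vsub-zeros α) (sym (noneTrue⇒allFalse S eq)) ⟩
  X (α , S) ∎
  where
  open ≡-Reasoning
  lem : ∀ b x → (if b ∧ noneTrue S then 1ℚ else 0ℚ) * x ≡ (if b then x else 0ℚ)
  lem true x rewrite eq = ℚP.*-identityˡ x
  lem false x = ℚP.*-zeroˡ x
... | false = trans (bosonic-* bosonic-1 ev α S (subst (λ b → T (not b)) (sym eq) _)) (sym (ev α S (subst (λ b → T (not b)) (sym eq) _)))

-- Determinants of Hessenberg matrices

minor : ∀ {N k} → Matrix N (suc k) → Fin (suc k) → Matrix N k
minor A j r c = A (F.suc r) (punchIn j c)

detTerm : ∀ {N k} → Matrix N (suc k) → Fin (suc k) → SP N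
detTerm A j = sign (odd (toℕ j)) • (A F.zero j *sp det (minor A j))

det-cong : ∀ {N k} (A B : Matrix N k) → (∀ r c → A r c ≋ B r c) → det A ≋ det B
det-cong {k = zero} A B eq = ≋-refl
det-cong {k = suc k} A B eq = sumSP-cong (L.allFin (suc k)) (detTerm A) (detTerm B)
  (λ j → •-cong (sign (odd (toℕ j))) (*sp-cong (eq F.zero j) (det-cong (minor A j) (minor B j) (λ r c → eq (F.suc r) (punchIn j c)))))

det-bosonic : ∀ {N k} (A : Matrix N k) → (∀ r c → Bosonic (A r c)) → Bosonic (det A)
det-bosonic {k = zero} A ev = bosonic-1
det-bosonic {k = suc k} A ev = bosonic-sumSP (L.allFin (suc k)) (detTerm A)
  (λ j → bosonic-• (sign (odd (toℕ j))) (bosonic-* (ev F.zero j) (det-bosonic (minor A j) (λ r c → ev (F.suc r) (punchIn j c)))))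

det-zeroColumn : ∀ {N k} (A : Matrix N k) (c : Fin k) → (∀ r → IsZero (A r c)) → IsZero (det A)
det-zeroColumn {k = zero} A () z
det-zeroColumn {k = suc k} A c z μ = trans (sumSP-map (L.allFin (suc k)) (detTerm A) μ) (∑-vanishes (L.allFin (suc k)) term-vanishes)
  where
  term-vanishes : ∀ j → detTerm A j μ ≡ 0ℚ
  term-vanishes j with j F.≟ c
  ... | yes refl = trans (cong (sign (odd (toℕ j)) *_) (*sp-zeroˡ (det (minor A j)) (z F.zero) μ)) (ℚP.*-zeroʳ (sign (odd (toℕ j))))
  ... | no j≢c = trans (cong (sign (odd (toℕ j)) *_)
           (*sp-zeroʳ (A F.zero j) (det-zeroColumn (minor A j) (punchOut j≢c)
              (λ r μ' → trans (cong (λ x → A (F.suc r) x μ') (FP.punchIn-punchOut j≢c)) (z (F.suc r) μ'))) μ))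
           (ℚP.*-zeroʳ (sign (odd (toℕ j))))

minor-zeroColumn : ∀ {N k} (A : Matrix N (suc k)) → (∀ r → IsZero (A (F.suc r) F.zero)) → (j : Fin k) →
  IsZero (det (minor A (F.suc j)))
minor-zeroColumn {k = suc _} A z j = det-zeroColumn (minor A (F.suc j)) F.zero z

det-firstColumn : ∀ {N k} (A : Matrix N (suc k)) q → A F.zero F.zero ≋ (q • 1sp) → (∀ r → IsZero (A (F.suc r) F.zero)) →
  (∀ r c → Bosonic (A (F.suc r) (F.suc c))) →
  det A ≋ (q • det (λ r c → A (F.suc r) (F.suc c)))
det-firstColumn {N} {k} A q e00 z ev μ = begin
  det A μ ≡⟨ sumSP-map (L.allFin (suc k)) (detTerm A) μ ⟩
  first + ∑ (L.tabulate F.suc) term ≡⟨ cong (first +_) (∑-tabulate-vanishes F.suc term later-terms-vanish) ⟩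
  first + 0ℚ ≡⟨ ℚP.+-identityʳ first ⟩
  first ≡⟨ ℚP.*-identityˡ ((A F.zero F.zero *sp D) μ) ⟩
  (A F.zero F.zero *sp D) μ ≡⟨ *sp-cong e00 (≋-refl {f = D}) μ ⟩
  ((q • 1sp) *sp D) μ ≡⟨ *sp-•ˡ q 1sp D μ ⟩
  q * (1sp *sp D) μ ≡⟨ cong (q *_) (*sp-identityˡ D (det-bosonic _ ev) μ) ⟩
  q * D μ ∎
  where
  open ≡-Reasoning
  D = det (λ r c → A (F.suc r) (F.suc c))
  term : Fin (suc k) → ℚ
  term j = detTerm A j μ
  first = term F.zero
  later-terms-vanish : ∀ j → term (F.suc j) ≡ 0ℚ
  later-terms-vanish j = trans (cong (sign (odd (toℕ (F.suc j))) *_) (*sp-zeroʳ (A F.zero (F.suc j)) (minor-zeroColumn A z j) μ)) (ℚP.*-zeroʳ (sign (odd (toℕ (F.suc j)))))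

toMatrix : ∀ {N} → (ℕ → ℕ → SP N) → ∀ k → Matrix N k
toMatrix M k r c = M (toℕ r) (toℕ c)

dropCorner : ∀ {N} → (ℕ → ℕ → SP N) → ℕ → ℕ → SP N
dropCorner M r c = M (suc r) (suc c)

dropCorners : ∀ {N} → ℕ → (ℕ → ℕ → SP N) → ℕ → ℕ → SP N
dropCorners zero M = M
dropCorners (suc j) M = dropCorners j (dropCorner M)

prodUpTo : (ℕ → ℚ) → ℕ → ℚ
prodUpTo d zero = 1ℚ
prodUpTo d (suc j) = d 1 * prodUpTo (λ r → d (suc r)) j

punchInℕ : ℕ → ℕ → ℕ
punchInℕ j c = if c ℕ.<ᵇ j then c else suc c

toℕ-punchIn : ∀ {k} (j : Fin (suc k)) (c : Fin k) → toℕ (punchIn j c) ≡ punchInℕ (toℕ j) (toℕ c)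
toℕ-punchIn F.zero c = refl
toℕ-punchIn (F.suc j) F.zero = refl
toℕ-punchIn (F.suc j) (F.suc c) = trans (cong suc (toℕ-punchIn j c)) (lem (toℕ c ℕ.<ᵇ toℕ j))
  where lem : ∀ b → suc (if b then toℕ c else suc (toℕ c)) ≡ (if b then suc (toℕ c) else suc (suc (toℕ c)))
        lem true = refl
        lem false = refl

punchInℕ-suc : ∀ j c → punchInℕ (suc j) (suc c) ≡ suc (punchInℕ j c)
punchInℕ-suc j c with c ℕ.<ᵇ j
... | true = refl
... | false = refl

ZeroBelowSubdiagonal : ∀ {N} → (ℕ → ℕ → SP N) → Set
ZeroBelowSubdiagonal M = ∀ r c → suc c ℕ.< r → IsZero (M r c)

ScalarSubdiagonal : ∀ {N} → (ℕ → ℕ → SP N) → (ℕ → ℚ) → Set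
ScalarSubdiagonal M d = ∀ r → M (suc r) r ≋ (d (suc r) • 1sp)

BosonicBelowFirstRow : ∀ {N} → (ℕ → ℕ → SP N) → Set
BosonicBelowFirstRow M = ∀ r c → Bosonic (M (suc r) c)

dropCorners≡ : ∀ {N} j (M : ℕ → ℕ → SP N) r c → dropCorners j M r c ≡ M (r ℕ.+ j) (c ℕ.+ j)
dropCorners≡ zero M r c = sym (cong₂ M (ℕP.+-identityʳ r) (ℕP.+-identityʳ c))
dropCorners≡ (suc j) M r c = trans (dropCorners≡ j (dropCorner M) r c) (sym (cong₂ M (ℕP.+-suc r j) (ℕP.+-suc c j)))

-- Deleting column j of a Hessenberg matrix leaves a block triangular minor whose first j diagonal
-- entries are the scalar subdiagonal entries d 1, …, d j.
det-hessenbergMinor : ∀ {N} j k → j ℕ.≤ k → (M : ℕ → ℕ → SP N) (d : ℕ → ℚ) →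
  ZeroBelowSubdiagonal M → ScalarSubdiagonal M d → BosonicBelowFirstRow M →
  det {N} {k} (λ r c → M (suc (toℕ r)) (punchInℕ j (toℕ c)))
    ≋ (prodUpTo d j • det (toMatrix (dropCorners (suc j) M) (k ℕ.∸ j)))
det-hessenbergMinor zero k _ M d hz hd ev = ≋-sym (•-identityˡ _)
det-hessenbergMinor {N} (suc j) (suc k) (ℕ.s≤s j≤k) M d hz hd ev = begin
  det A
    ≈⟨ det-firstColumn A (d 1) (hd 0) (λ r → hz (suc (suc (toℕ r))) 0 (ℕ.s≤s (ℕ.s≤s ℕ.z≤n)))
                        (λ r c → ev (suc (toℕ r)) (punchInℕ (suc j) (toℕ (F.suc c)))) ⟩
  d 1 • det {N} {k} (λ r c → A (F.suc r) (F.suc c))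
    ≈⟨ •-cong (d 1) (det-cong {N} {k} _ _ (λ r c μ → cong (λ x → M (suc (suc (toℕ r))) x μ) (punchInℕ-suc j (toℕ c)))) ⟩
  d 1 • det {N} {k} (λ r c → dropCorner M (suc (toℕ r)) (punchInℕ j (toℕ c)))
    ≈⟨ •-cong (d 1) (det-hessenbergMinor j k j≤k (dropCorner M) (λ r → d (suc r))
                       (λ r c p → hz (suc r) (suc c) (ℕ.s≤s p)) (λ r → hd (suc r)) (λ r c → ev (suc r) (suc c))) ⟩
  d 1 • (prodUpTo (λ r → d (suc r)) j • det (toMatrix (dropCorners (suc j) (dropCorner M)) (k ℕ.∸ j)))
    ≈⟨ •-assoc (d 1) (prodUpTo (λ r → d (suc r)) j) _ ⟩
  prodUpTo d (suc j) • det (toMatrix (dropCorners (suc (suc j)) M) (suc k ℕ.∸ suc j)) ∎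
  where
  A : Matrix _ (suc k)
  A r c = M (suc (toℕ r)) (punchInℕ (suc j) (toℕ c))
  open import Relation.Binary.Reasoning.Setoid (≋-setoid N)

hessenbergTerm : ∀ {N} → ℕ → (ℕ → ℕ → SP N) → (ℕ → ℚ) → ℕ → SP N
hessenbergTerm k M d j = sign (odd j) • (M 0 j *sp (prodUpTo d j • det (toMatrix (dropCorners (suc j) M) (k ℕ.∸ j))))

det-hessenberg : ∀ {N} k (M : ℕ → ℕ → SP N) d → ZeroBelowSubdiagonal M → ScalarSubdiagonal M d → BosonicBelowFirstRow M →
  det (toMatrix M (suc k)) ≋ sumSP (map (hessenbergTerm k M d) (upTo (suc k)))
det-hessenberg {N} k M d hz hd ev μ = begin
  det (toMatrix M (suc k)) μ ≡⟨ sumSP-map (L.allFin (suc k)) (detTerm (toMatrix M (suc k))) μ ⟩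
  ∑ (L.allFin (suc k)) (λ j → detTerm (toMatrix M (suc k)) j μ)
     ≡⟨ ∑-tabulate-upTo (suc k) (λ i → i) (λ j → detTerm (toMatrix M (suc k)) j μ) (λ x → x) (λ j → hessenbergTerm k M d j μ) term≡hessenbergTerm ⟩
  ∑ (upTo (suc k)) (λ j → hessenbergTerm k M d j μ) ≡⟨ sym (sumSP-map (upTo (suc k)) (hessenbergTerm k M d) μ) ⟩
  sumSP (map (hessenbergTerm k M d) (upTo (suc k))) μ ∎
  where
  open ≡-Reasoning
  term≡hessenbergTerm : ∀ i → detTerm (toMatrix M (suc k)) i μ ≡ hessenbergTerm k M d (toℕ i) μ
  term≡hessenbergTerm i = •-cong (sign (odd (toℕ i))) (*sp-cong (≋-refl {f = M 0 (toℕ i)})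
     (≋-trans (det-cong (minor (toMatrix M (suc k)) i) (λ r c → M (suc (toℕ r)) (punchInℕ (toℕ i) (toℕ c)))
                (λ r c μ' → cong (λ x → M (suc (toℕ r)) x μ') (toℕ-punchIn i c)))
              (det-hessenbergMinor (toℕ i) k (FP.toℕ≤pred[n] i) M d hz hd ev))) μ

-- Coefficients of h_n and h̃_n

count : List ℕ → List (List ℕ) → ℚ
count Lst xs = ∑ xs (λ l → if Lst ==L l then 1ℚ else 0ℚ)

data Descending : ℕ → List ℕ → Set where
  dnil : ∀ {k} → Descending k []
  dcons : ∀ {k x l} → 1 ℕ.≤ x → x ℕ.≤ k → Descending x l → Descending k (x ∷ l)

count-∷ : ∀ x l p (ys : List (List ℕ)) → count (x ∷ l) (map (p ∷_) ys) ≡ (if x ℕ.≡ᵇ p then count l ys else 0ℚ)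
count-∷ x l p ys = trans (∑-map ys (p ∷_) (λ m → if (x ∷ l) ==L m then 1ℚ else 0ℚ)) (lem (x ℕ.≡ᵇ p))
  where
  lem : ∀ b → ∑ ys (λ y → if b ∧ (l ==L y) then 1ℚ else 0ℚ) ≡ (if b then count l ys else 0ℚ)
  lem true = refl
  lem false = ∑-zero ys

count-[]-∷ : ∀ p (ys : List (List ℕ)) → count [] (map (p ∷_) ys) ≡ 0ℚ
count-[]-∷ p ys = trans (∑-map ys (p ∷_) (λ m → if [] ==L m then 1ℚ else 0ℚ)) (∑-zero ys)

partsStep : ℕ → ℕ → ℕ → List (List ℕ)
partsStep fuel n k = concatMap (λ p → map (suc p ∷_) (partsF fuel (n ℕ.∸ suc p) (suc p)))
            (filter (λ p → suc p ℕ.≤? n) (filter (λ p → suc p ℕ.≤? k) (upTo n)))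

∑-partsStep : ∀ fuel n k (F : List ℕ → ℚ) → ∑ (partsStep fuel n k) F ≡
  ∑ (upTo n) (λ p → if suc p ℕ.≤ᵇ k then (if suc p ℕ.≤ᵇ n then ∑ (map (suc p ∷_) (partsF fuel (n ℕ.∸ suc p) (suc p))) F else 0ℚ) else 0ℚ)
∑-partsStep fuel n k F = trans (∑-concatMap (filter (λ p → suc p ℕ.≤? n) (filter (λ p → suc p ℕ.≤? k) (upTo n))) G F)
  (trans (∑-filter (λ p → suc p ℕ.≤? n) (filter (λ p → suc p ℕ.≤? k) (upTo n)) (λ p → ∑ (G p) F))
         (∑-filter (λ p → suc p ℕ.≤? k) (upTo n) (λ p → if suc p ℕ.≤ᵇ n then ∑ (G p) F else 0ℚ)))
  where G = λ p → map (suc p ∷_) (partsF fuel (n ℕ.∸ suc p) (suc p))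

if-0ℚ : ∀ b → (if b then 0ℚ else 0ℚ) ≡ 0ℚ
if-0ℚ true = refl
if-0ℚ false = refl

count-partsF-wrongSum : ∀ fuel n k l → sum l ≢ n → count l (partsF fuel n k) ≡ 0ℚ
count-partsF-wrongSum zero zero k [] ne = ⊥-elim (ne refl)
count-partsF-wrongSum zero zero k (x ∷ l) ne = refl
count-partsF-wrongSum zero (suc n) k l ne = refl
count-partsF-wrongSum (suc fuel) zero k [] ne = ⊥-elim (ne refl)
count-partsF-wrongSum (suc fuel) zero k (x ∷ l) ne = refl
count-partsF-wrongSum (suc fuel) (suc n) k l ne = trans (∑-partsStep fuel (suc n) k _) (∑-vanishes (upTo (suc n)) (tm l ne))
  where
  tm : ∀ l → sum l ≢ suc n → ∀ p →
    (if suc p ℕ.≤ᵇ k then (if suc p ℕ.≤ᵇ suc n then count l (map (suc p ∷_) (partsF fuel (suc n ℕ.∸ suc p) (suc p))) else 0ℚ) else 0ℚ) ≡ 0ℚ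
  tm l ne p with suc p ℕ.≤ᵇ k | suc p ℕ.≤ᵇ suc n in le
  ... | false | _ = refl
  ... | true | false = refl
  tm [] ne p | true | true = count-[]-∷ (suc p) (partsF fuel (suc n ℕ.∸ suc p) (suc p))
  tm (x ∷ l') ne p | true | true = trans (count-∷ x l' (suc p) (partsF fuel (suc n ℕ.∸ suc p) (suc p))) (inner (x ℕ.≡ᵇ suc p) refl)
    where
    inner : ∀ b → b ≡ (x ℕ.≡ᵇ suc p) → (if b then count l' (partsF fuel (suc n ℕ.∸ suc p) (suc p)) else 0ℚ) ≡ 0ℚ
    inner false _ = refl
    inner true e = count-partsF-wrongSum fuel (n ℕ.∸ p) (suc p) l' (λ s → ne (begin
      x ℕ.+ sum l' ≡⟨ cong₂ ℕ._+_ (≡ᵇ≡true⇒≡ (sym e)) s ⟩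
      suc p ℕ.+ (n ℕ.∸ p) ≡⟨ ℕP.m+[n∸m]≡n (ℕP.≤ᵇ⇒≤ (suc p) (suc n) (≡→T le)) ⟩
      suc n ∎))
      where open ≡-Reasoning

if³-swap : ∀ a b c (X : ℚ) → (if a then (if b then (if c then X else 0ℚ) else 0ℚ) else 0ℚ)
  ≡ (if c then (if a then (if b then X else 0ℚ) else 0ℚ) else 0ℚ)
if³-swap true true c X = refl
if³-swap true false true X = refl
if³-swap true false false X = refl
if³-swap false b true X = refl
if³-swap false b false X = refl

count-partsF-descending : ∀ fuel n k l → Descending k l → sum l ≡ n → n ℕ.≤ fuel → count l (partsF fuel n k) ≡ 1ℚ
count-partsF-descending zero .0 k [] d refl le = ℚP.+-identityʳ 1ℚ
count-partsF-descending zero n k (x ∷ l) (dcons (ℕ.s≤s ℕ.z≤n) _ _) refl ()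
count-partsF-descending (suc fuel) .0 k [] d refl le = ℚP.+-identityʳ 1ℚ
count-partsF-descending (suc fuel) .(suc x ℕ.+ sum l) k (suc x ∷ l) (dcons _ xk dl) refl (ℕ.s≤s le) = begin
  count (suc x ∷ l) (partsF (suc fuel) n k) ≡⟨ ∑-partsStep fuel n k (λ m → if (suc x ∷ l) ==L m then 1ℚ else 0ℚ) ⟩
  ∑ (upTo n) (λ p → if suc p ℕ.≤ᵇ k then (if suc p ℕ.≤ᵇ n then count (suc x ∷ l) (map (suc p ∷_) (Y p)) else 0ℚ) else 0ℚ)
     ≡⟨ ∑-cong (upTo n) (λ p → trans (cong (λ z → if suc p ℕ.≤ᵇ k then (if suc p ℕ.≤ᵇ n then z else 0ℚ) else 0ℚ) (count-∷ (suc x) l (suc p) (Y p)))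
             (if³-swap (suc p ℕ.≤ᵇ k) (suc p ℕ.≤ᵇ n) (x ℕ.≡ᵇ p) (count l (Y p)))) ⟩
  ∑ (upTo n) (λ p → if x ℕ.≡ᵇ p then G p else 0ℚ) ≡⟨ ∑-upTo-delta n x G ⟩
  (if x ℕ.<ᵇ n then G x else 0ℚ) ≡⟨ cong (λ b → if b then G x else 0ℚ) (<⇒<ᵇ≡true (ℕ.s≤s (ℕP.m≤m+n x (sum l)))) ⟩
  G x ≡⟨ cong₂ (λ a b → if a then (if b then count l (Y x) else 0ℚ) else 0ℚ) (≤⇒≤ᵇ≡true xk) (≤⇒≤ᵇ≡true (ℕ.s≤s (ℕP.m≤m+n x (sum l)))) ⟩
  count l (Y x) ≡⟨ count-partsF-descending fuel (n ℕ.∸ suc x) (suc x) l dl (sym (ℕP.m+n∸m≡n (suc x) (sum l)))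
                   (subst (ℕ._≤ fuel) (sym (ℕP.m+n∸m≡n (suc x) (sum l))) (ℕP.m+n≤o⇒n≤o x le)) ⟩
  1ℚ ∎
  where
  open ≡-Reasoning
  n = suc x ℕ.+ sum l
  Y : ℕ → List (List ℕ)
  Y p = partsF fuel (n ℕ.∸ suc p) (suc p)
  G : ℕ → ℚ
  G p = if suc p ℕ.≤ᵇ k then (if suc p ℕ.≤ᵇ n then count l (Y p) else 0ℚ) else 0ℚ

descending-weaken : ∀ {k k' l} → k ℕ.≤ k' → Descending k l → Descending k' l
descending-weaken kk dnil = dnil
descending-weaken kk (dcons a b d) = dcons a (ℕP.≤-trans b kk) d

insertDesc-descending : ∀ {k x} l → Descending k l → 1 ℕ.≤ x → x ℕ.≤ k → Descending k (insertDesc x l)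
insertDesc-descending [] dnil px xk = dcons px xk dnil
insertDesc-descending {k} {x} (y ∷ l) (dcons py yk dl) px xk with y ℕ.≤ᵇ x in eq
... | true = dcons px xk (dcons py (ℕP.≤ᵇ⇒≤ y x (≡→T eq)) dl)
... | false = dcons py yk (insertDesc-descending l dl px (ℕP.<⇒≤ (ℕP.≰⇒> (λ p → subst T eq (ℕP.≤⇒≤ᵇ p)))))

sum-insertDesc : ∀ x l → sum (insertDesc x l) ≡ x ℕ.+ sum l
sum-insertDesc x [] = refl
sum-insertDesc x (y ∷ l) with y ℕ.≤ᵇ x
... | true = refl
... | false = trans (cong (y ℕ.+_) (sum-insertDesc x l)) (x∙yz≈y∙xz y x (sum l))

sum-sortDesc : ∀ l → sum (sortDesc l) ≡ sum l
sum-sortDesc [] = refl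
sum-sortDesc (x ∷ l) = trans (sum-insertDesc x (sortDesc l)) (cong (x ℕ.+_) (sum-sortDesc l))

sortDesc-descending : ∀ l → All (1 ℕ.≤_) l → Descending (sum l) (sortDesc l)
sortDesc-descending [] [] = dnil
sortDesc-descending (x ∷ l) (px ∷ pl) = insertDesc-descending (sortDesc l)
  (descending-weaken (ℕP.m≤n+m (sum l) x) (sortDesc-descending l pl)) px (ℕP.m≤m+n x (sum l))

insertDesc-nonempty : ∀ x l → (insertDesc x l ==L []) ≡ false
insertDesc-nonempty x [] = refl
insertDesc-nonempty x (y ∷ l) with y ℕ.≤ᵇ x
... | true = refl
... | false = refl

sortDesc-nonempty : ∀ x l → (sortDesc (x ∷ l) ==L []) ≡ false
sortDesc-nonempty x l = insertDesc-nonempty x (sortDesc l)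

fermExps-allFalse : ∀ {N} (α : Vec ℕ N) → fermExps α allFalse ≡ []
fermExps-allFalse [] = refl
fermExps-allFalse (a ∷ α) = fermExps-allFalse α

bosExps-positive : ∀ {N} (α : Vec ℕ N) S → All (1 ℕ.≤_) (bosExps α S)
bosExps-positive [] [] = []
bosExps-positive (a ∷ α) (true ∷ S) = bosExps-positive α S
bosExps-positive (zero ∷ α) (false ∷ S) = bosExps-positive α S
bosExps-positive (suc a ∷ α) (false ∷ S) = ℕ.s≤s ℕ.z≤n ∷ bosExps-positive α S

sumV-fermExps-bosExps : ∀ {N} (α : Vec ℕ N) S → sumV α ≡ sum (fermExps α S) ℕ.+ sum (bosExps α S)
sumV-fermExps-bosExps [] [] = refl
sumV-fermExps-bosExps (a ∷ α) (true ∷ S) = trans (cong (a ℕ.+_) (sumV-fermExps-bosExps α S)) (sym (ℕP.+-assoc a _ _))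
sumV-fermExps-bosExps (zero ∷ α) (false ∷ S) = sumV-fermExps-bosExps α S
sumV-fermExps-bosExps (suc a ∷ α) (false ∷ S) =
  trans (cong (suc a ℕ.+_) (sumV-fermExps-bosExps α S)) (x∙yz≈y∙xz (suc a) (sum (fermExps α S)) (sum (bosExps α S)))

fermExps-nonempty : ∀ {N} (α : Vec ℕ N) S → noneTrue S ≡ false → (sortDesc (fermExps α S) ==L []) ≡ false
fermExps-nonempty (a ∷ α) (true ∷ S) eq = sortDesc-nonempty a (fermExps α S)
fermExps-nonempty (a ∷ α) (false ∷ S) eq = fermExps-nonempty α S eq

∑-SPar0 : ∀ n (F : SPart → ℚ) → ∑ (SPar n 0) F ≡ ∑ (partitions n) (λ s → F ([] , s))
∑-SPar0 n F = begin
  ∑ (SPar n 0) F ≡⟨ ∑-concatMap (upTo (suc n)) K F ⟩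
  ∑ (upTo (suc n)) (λ k → ∑ (K k) F) ≡⟨⟩
  ∑ (K 0) F + ∑ (L.applyUpTo suc n) (λ k → ∑ (K k) F)
    ≡⟨ cong₂ _+_ (∑-concatMap ([] ∷ []) (λ a → map (λ s → (a , s)) (partitions (n ℕ.∸ 0))) F)
                 (∑-applyUpTo-suc-vanishes n (λ x → x) (λ k → ∑ (K k) F) (λ x → refl)) ⟩
  (∑ (map (λ s → ([] , s)) (partitions n)) F + 0ℚ) + 0ℚ
    ≡⟨ trans (ℚP.+-identityʳ _) (trans (ℚP.+-identityʳ _) (∑-map (partitions n) (λ s → ([] , s)) F)) ⟩
  ∑ (partitions n) (λ s → F ([] , s)) ∎
  where
  open ≡-Reasoning
  K : ℕ → List SPart
  K k = concatMap (λ a → map (λ s → (a , s)) (partitions (n ℕ.∸ k))) (strictParts 0 k (suc n))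

count-partitions : ∀ m l → All (1 ℕ.≤_) l → count (sortDesc l) (partitions m) ≡ (if sum l ℕ.≡ᵇ m then 1ℚ else 0ℚ)
count-partitions m l pl = go (sum l ℕ.≡ᵇ m) refl
  where
  go : ∀ b → (sum l ℕ.≡ᵇ m) ≡ b → count (sortDesc l) (partitions m) ≡ (if b then 1ℚ else 0ℚ)
  go true e = count-partsF-descending m m m (sortDesc l) (subst (λ z → Descending z (sortDesc l)) (≡ᵇ≡true⇒≡ e) (sortDesc-descending l pl))
                (trans (sum-sortDesc l) (≡ᵇ≡true⇒≡ e)) ℕP.≤-refl
  go false e = count-partsF-wrongSum m m m (sortDesc l) (λ s → ≡ᵇ≡false⇒≢ e (trans (sym (sum-sortDesc l)) s))

h-coeff : ∀ {N} n (α : Vec ℕ N) S → h n (α , S) ≡ (if noneTrue S ∧ (sumV α ℕ.≡ᵇ n) then 1ℚ else 0ℚ)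
h-coeff {N} n α S = trans (sumSP-map (SPar n 0) mono (α , S)) (trans (∑-SPar0 n (λ Λ → mono Λ (α , S))) (go (noneTrue S) refl))
  where
  go : ∀ b → noneTrue S ≡ b → ∑ (partitions n) (λ s → mono ([] , s) (α , S)) ≡ (if b ∧ (sumV α ℕ.≡ᵇ n) then 1ℚ else 0ℚ)
  go false eq = ∑-vanishes (partitions n) (λ s →
    cong (λ z → if z ∧ (sortDesc (bosExps α S) ==L s) then sign (odd (inversions (fermExps α S))) else 0ℚ) (fermExps-nonempty α S eq))
  go true eq rewrite noneTrue⇒allFalse S eq | fermExps-allFalse α =
    trans (count-partitions n (bosExps α allFalse) (bosExps-positive α allFalse))
          (cong (λ m → if m ℕ.≡ᵇ n then 1ℚ else 0ℚ)
                (sym (trans (sumV-fermExps-bosExps α allFalse) (cong (λ f → sum f ℕ.+ sum (bosExps α allFalse)) (fermExps-allFalse α)))))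

oneTrue : ∀ {N} → Vec Bool N → Bool
oneTrue [] = false
oneTrue (true ∷ S) = noneTrue S
oneTrue (false ∷ S) = oneTrue S

fermExp : ∀ {N} → Vec ℕ N → Vec Bool N → ℕ
fermExp [] [] = 0
fermExp (a ∷ α) (true ∷ S) = a
fermExp (a ∷ α) (false ∷ S) = fermExp α S

fermExps-none : ∀ {N} (α : Vec ℕ N) S → noneTrue S ≡ true → fermExps α S ≡ []
fermExps-none α S eq rewrite noneTrue⇒allFalse S eq = fermExps-allFalse α

fermExps-one : ∀ {N} (α : Vec ℕ N) S → oneTrue S ≡ true → fermExps α S ≡ fermExp α S ∷ []
fermExps-one (a ∷ α) (true ∷ S) eq = cong (a ∷_) (fermExps-none α S eq)
fermExps-one (a ∷ α) (false ∷ S) eq = fermExps-one α S eq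

fermExps-∷ : ∀ {N} (α : Vec ℕ N) S → noneTrue S ≡ false → Σ ℕ (λ x → Σ (List ℕ) (λ l → fermExps α S ≡ x ∷ l))
fermExps-∷ (a ∷ α) (true ∷ S) eq = a , fermExps α S , refl
fermExps-∷ (a ∷ α) (false ∷ S) eq = fermExps-∷ α S eq

sortDesc-two : ∀ x y l k → (sortDesc (x ∷ y ∷ l) ==L (k ∷ [])) ≡ false
sortDesc-two x y l k = lem2 (insertDesc y (sortDesc l)) (insertDesc-nonempty y (sortDesc l))
  where
  lem1 : ∀ z r → (insertDesc x (z ∷ r) ==L (k ∷ [])) ≡ false
  lem1 z r with z ℕ.≤ᵇ x
  ... | true = BP.∧-zeroʳ (x ℕ.≡ᵇ k)
  ... | false = trans (cong ((z ℕ.≡ᵇ k) ∧_) (insertDesc-nonempty x r)) (BP.∧-zeroʳ (z ℕ.≡ᵇ k))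
  lem2 : ∀ m → (m ==L []) ≡ false → (insertDesc x m ==L (k ∷ [])) ≡ false
  lem2 [] ()
  lem2 (z ∷ r) _ = lem1 z r

fermExps-notOne : ∀ {N} (α : Vec ℕ N) S k → oneTrue S ≡ false → (sortDesc (fermExps α S) ==L (k ∷ [])) ≡ false
fermExps-notOne [] [] k eq = refl
fermExps-notOne (a ∷ α) (true ∷ S) k eq with fermExps-∷ α S eq
... | x , l , e rewrite e = sortDesc-two a x l k
fermExps-notOne (a ∷ α) (false ∷ S) k eq = fermExps-notOne α S k eq

if-∸-delta : ∀ p k (X : ℚ) → (if p ℕ.≤ᵇ k then (if (k ℕ.∸ p) ℕ.≡ᵇ 0 then X else 0ℚ) else 0ℚ) ≡ (if k ℕ.≡ᵇ p then X else 0ℚ)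
if-∸-delta zero k X = refl
if-∸-delta (suc p) zero X = refl
if-∸-delta (suc p) (suc k) X rewrite <ᵇ-suc p k = if-∸-delta p k X

∑-strictParts1 : ∀ n k (G : List ℕ → ℚ) → ∑ (strictParts 1 k (suc n)) G ≡ (if k ℕ.<ᵇ suc n then G (k ∷ []) else 0ℚ)
∑-strictParts1 n k G = begin
  ∑ (strictParts 1 k (suc n)) G ≡⟨ ∑-concatMap (filter (λ p → p ℕ.≤? k) (upTo (suc n))) W G ⟩
  ∑ (filter (λ p → p ℕ.≤? k) (upTo (suc n))) (λ p → ∑ (W p) G) ≡⟨ ∑-filter (λ p → p ℕ.≤? k) (upTo (suc n)) (λ p → ∑ (W p) G) ⟩
  ∑ (upTo (suc n)) (λ p → if p ℕ.≤ᵇ k then ∑ (W p) G else 0ℚ) ≡⟨ ∑-cong (upTo (suc n)) pt ⟩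
  ∑ (upTo (suc n)) (λ p → if k ℕ.≡ᵇ p then G (p ∷ []) else 0ℚ) ≡⟨ ∑-upTo-delta (suc n) k (λ p → G (p ∷ [])) ⟩
  (if k ℕ.<ᵇ suc n then G (k ∷ []) else 0ℚ) ∎
  where
  open ≡-Reasoning
  W : ℕ → List (List ℕ)
  W p = map (p ∷_) (strictParts 0 (k ℕ.∸ p) p)
  inner : ∀ p b → ∑ (map (p ∷_) (if b then [] ∷ [] else [])) G ≡ (if b then G (p ∷ []) else 0ℚ)
  inner p true = ℚP.+-identityʳ (G (p ∷ []))
  inner p false = refl
  pt : ∀ p → (if p ℕ.≤ᵇ k then ∑ (W p) G else 0ℚ) ≡ (if k ℕ.≡ᵇ p then G (p ∷ []) else 0ℚ)
  pt p = trans (cong (λ z → if p ℕ.≤ᵇ k then z else 0ℚ) (inner p ((k ℕ.∸ p) ℕ.≡ᵇ 0))) (if-∸-delta p k (G (p ∷ [])))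

∑-SPar1 : ∀ n (F : SPart → ℚ) → ∑ (SPar n 1) F ≡
  ∑ (upTo (suc n)) (λ k → if k ℕ.<ᵇ suc n then ∑ (partitions (n ℕ.∸ k)) (λ s → F (k ∷ [] , s)) else 0ℚ)
∑-SPar1 n F = trans (∑-concatMap (upTo (suc n)) K F) (∑-cong (upTo (suc n)) (λ k →
    trans (∑-concatMap (strictParts 1 k (suc n)) (λ a → map (λ s → (a , s)) (partitions (n ℕ.∸ k))) F)
   (trans (∑-strictParts1 n k (λ a → ∑ (map (λ s → (a , s)) (partitions (n ℕ.∸ k))) F))
          (cong (λ z → if k ℕ.<ᵇ suc n then z else 0ℚ) (∑-map (partitions (n ℕ.∸ k)) (λ s → (k ∷ [] , s)) F)))))
  where
  K : ℕ → List SPart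
  K k = concatMap (λ a → map (λ s → (a , s)) (partitions (n ℕ.∸ k))) (strictParts 1 k (suc n))

ht-unfold : ∀ {N} n (μ : Mon N) → ht n μ ≡
  ∑ (upTo (suc n)) (λ k → if k ℕ.<ᵇ suc n then ∑ (partitions (n ℕ.∸ k)) (λ s → fromℕ (suc k) * mono (k ∷ [] , s) μ) else 0ℚ)
ht-unfold n μ = trans (sumSP-map (SPar n 1) _ μ) (∑-SPar1 n _)

if²-swap : ∀ a c (X : ℚ) → (if a then (if c then X else 0ℚ) else 0ℚ) ≡ (if c then (if a then X else 0ℚ) else 0ℚ)
if²-swap true c X = refl
if²-swap false true X = refl
if²-swap false false X = refl

mono-oneFermion : ∀ {N} (α : Vec ℕ N) S k s → oneTrue S ≡ true →
  mono (k ∷ [] , s) (α , S) ≡ (if (fermExp α S ℕ.≡ᵇ k) ∧ (sortDesc (bosExps α S) ==L s) then 1ℚ else 0ℚ)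
mono-oneFermion α S k s eq = lem (fermExps α S) (fermExps-one α S eq)
  where
  lem : ∀ f → f ≡ fermExp α S ∷ [] → (if (sortDesc f ==L (k ∷ [])) ∧ (sortDesc (bosExps α S) ==L s) then sign (odd (inversions f)) else 0ℚ)
        ≡ (if (fermExp α S ℕ.≡ᵇ k) ∧ (sortDesc (bosExps α S) ==L s) then 1ℚ else 0ℚ)
  lem .(fermExp α S ∷ []) refl = cong (λ b → if b ∧ (sortDesc (bosExps α S) ==L s) then 1ℚ else 0ℚ) (BP.∧-identityʳ (fermExp α S ℕ.≡ᵇ k))

mono-notOneFermion : ∀ {N} (α : Vec ℕ N) S k s → oneTrue S ≡ false → mono (k ∷ [] , s) (α , S) ≡ 0ℚ
mono-notOneFermion α S k s eq =
  cong (λ b → if b ∧ (sortDesc (bosExps α S) ==L s) then sign (odd (inversions (fermExps α S))) else 0ℚ) (fermExps-notOne α S k eq)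

ht-coeff : ∀ {N} n (α : Vec ℕ N) S → ht n (α , S) ≡ (if oneTrue S ∧ (sumV α ℕ.≡ᵇ n) then fromℕ (suc (fermExp α S)) else 0ℚ)
ht-coeff {N} n α S = trans (ht-unfold n (α , S)) (go (oneTrue S) refl)
  where
  B = sortDesc (bosExps α S)
  y = fermExp α S
  go : ∀ b → oneTrue S ≡ b → ∑ (upTo (suc n)) (λ k → if k ℕ.<ᵇ suc n then ∑ (partitions (n ℕ.∸ k)) (λ s →
    fromℕ (suc k) * mono (k ∷ [] , s) (α , S)) else 0ℚ)
                         ≡ (if b ∧ (sumV α ℕ.≡ᵇ n) then fromℕ (suc y) else 0ℚ)
  go false eq = ∑-vanishes (upTo (suc n)) (λ k → trans (cong (λ z → if k ℕ.<ᵇ suc n then z else 0ℚ)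
      (∑-vanishes (partitions (n ℕ.∸ k)) (λ s → trans (cong (fromℕ (suc k) *_) (mono-notOneFermion α S k s eq)) (ℚP.*-zeroʳ (fromℕ (suc k)))))) (if-0ℚ (k ℕ.<ᵇ suc n)))
  go true eq = begin
    ∑ (upTo (suc n)) (λ k → if k ℕ.<ᵇ suc n then ∑ (partitions (n ℕ.∸ k)) (λ s → fromℕ (suc k) * mono (k ∷ [] , s) (α , S)) else 0ℚ)
      ≡⟨ ∑-cong (upTo (suc n)) (λ k → trans (cong (λ z → if k ℕ.<ᵇ suc n then z else 0ℚ) (trans (∑-cong (partitions (n ℕ.∸ k)) (λ s → cong (fromℕ (suc k) *_) (mono-oneFermion α S k s eq))) (inner k (y ℕ.≡ᵇ k))))
                                         (if²-swap (k ℕ.<ᵇ suc n) (y ℕ.≡ᵇ k) (X k))) ⟩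
    ∑ (upTo (suc n)) (λ k → if y ℕ.≡ᵇ k then (if k ℕ.<ᵇ suc n then X k else 0ℚ) else 0ℚ)
      ≡⟨ ∑-upTo-delta (suc n) y (λ k → if k ℕ.<ᵇ suc n then X k else 0ℚ) ⟩
    (if y ℕ.<ᵇ suc n then (if y ℕ.<ᵇ suc n then X y else 0ℚ) else 0ℚ) ≡⟨ fin (y ℕ.≤? n) ⟩
    (if sumV α ℕ.≡ᵇ n then fromℕ (suc y) else 0ℚ) ∎
    where
    open ≡-Reasoning
    X : ℕ → ℚ
    X k = fromℕ (suc k) * count B (partitions (n ℕ.∸ k))
    inner : ∀ k b → ∑ (partitions (n ℕ.∸ k)) (λ s → fromℕ (suc k) * (if b ∧ (B ==L s) then 1ℚ else 0ℚ)) ≡ (if b then X k else 0ℚ)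
    inner k true = ∑-*ˡ (partitions (n ℕ.∸ k)) (fromℕ (suc k)) (λ s → if B ==L s then 1ℚ else 0ℚ)
    inner k false = ∑-vanishes (partitions (n ℕ.∸ k)) (λ s → ℚP.*-zeroʳ (fromℕ (suc k)))
    sV : sumV α ≡ y ℕ.+ sum (bosExps α S)
    sV = trans (sumV-fermExps-bosExps α S) (trans (cong (λ f → sum f ℕ.+ sum (bosExps α S)) (fermExps-one α S eq)) (cong (ℕ._+ sum (bosExps α S)) (ℕP.+-identityʳ y)))
    fin : Dec (y ℕ.≤ n) → (if y ℕ.<ᵇ suc n then (if y ℕ.<ᵇ suc n then X y else 0ℚ) else 0ℚ) ≡ (if sumV α ℕ.≡ᵇ n then fromℕ (suc y) else 0ℚ)
    fin (yes p) rewrite <⇒<ᵇ≡true (ℕ.s≤s p) | sV | +≡ᵇ-shift y (sum (bosExps α S)) n p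
      | count-partitions (n ℕ.∸ y) (bosExps α S) (bosExps-positive α S) with sum (bosExps α S) ℕ.≡ᵇ n ℕ.∸ y
    ... | true = ℚP.*-identityʳ (fromℕ (suc y))
    ... | false = ℚP.*-zeroʳ (fromℕ (suc y))
    fin (no p) rewrite ≮⇒<ᵇ≡false (λ q → p (ℕP.≤-pred q)) | sV | +≡ᵇ-over y (sum (bosExps α S)) n (ℕP.≰⇒> p) = refl

data _≤v_ : ∀ {N} → Vec ℕ N → Vec ℕ N → Set where
  vnil : [] ≤v []
  vcons : ∀ {N b a} {β α : Vec ℕ N} → b ℕ.≤ a → β ≤v α → (b ∷ β) ≤v (a ∷ α)

∑-below-cong : ∀ {N} (α : Vec ℕ N) {f g : Vec ℕ N → ℚ} → (∀ β → β ≤v α → f β ≡ g β) → ∑ (below α) f ≡ ∑ (below α) g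
∑-below-cong [] eq = cong (_+ 0ℚ) (eq [] vnil)
∑-below-cong (a ∷ α) {f} {g} eq = trans (∑-below-∷ a α f) (trans
  (∑-cong-upTo (suc a) (λ b p → ∑-below-cong α (λ β q → eq (b ∷ β) (vcons (ℕP.≤-pred p) q))))
  (sym (∑-below-∷ a α g)))

sumV-vsub : ∀ {N} {β α : Vec ℕ N} → β ≤v α → sumV β ℕ.+ sumV (vsub α β) ≡ sumV α
sumV-vsub vnil = refl
sumV-vsub {β = b ∷ β} {a ∷ α} (vcons p q) = begin
  b ℕ.+ sumV β ℕ.+ ((a ℕ.∸ b) ℕ.+ sumV (vsub α β)) ≡⟨ interchange b (sumV β) (a ℕ.∸ b) (sumV (vsub α β)) ⟩
  (b ℕ.+ (a ℕ.∸ b)) ℕ.+ (sumV β ℕ.+ sumV (vsub α β)) ≡⟨ cong₂ ℕ._+_ (ℕP.m+[n∸m]≡n p) (sumV-vsub q) ⟩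
  a ℕ.+ sumV α ∎
  where open ≡-Reasoning

noneTrue-allFalse : ∀ {N} → noneTrue {N} allFalse ≡ true
noneTrue-allFalse {zero} = refl
noneTrue-allFalse {suc N} = noneTrue-allFalse {N}

allZero≡sumV≡ᵇ0 : ∀ {N} (β : Vec ℕ N) → allZero β ≡ (sumV β ℕ.≡ᵇ 0)
allZero≡sumV≡ᵇ0 [] = refl
allZero≡sumV≡ᵇ0 (zero ∷ β) = allZero≡sumV≡ᵇ0 β
allZero≡sumV≡ᵇ0 (suc b ∷ β) = refl

∑-convolution-delta : ∀ n b c (W : ℕ → ℚ) (X : ℚ) (Y : ℚ) →
  ∑ (upTo (suc n)) (λ j → W j * ((if b ℕ.≡ᵇ j then X else 0ℚ) * (if c ℕ.≡ᵇ n ℕ.∸ j then Y else 0ℚ)))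
  ≡ (if b ℕ.+ c ℕ.≡ᵇ n then W b * (X * Y) else 0ℚ)
∑-convolution-delta n b c W X Y = begin
  ∑ (upTo (suc n)) (λ j → W j * ((if b ℕ.≡ᵇ j then X else 0ℚ) * R j))
    ≡⟨ ∑-cong (upTo (suc n)) (λ j → pt j (b ℕ.≡ᵇ j)) ⟩
  ∑ (upTo (suc n)) (λ j → if b ℕ.≡ᵇ j then W j * (X * R j) else 0ℚ) ≡⟨ ∑-upTo-delta (suc n) b (λ j → W j * (X * R j)) ⟩
  (if b ℕ.<ᵇ suc n then W b * (X * R b) else 0ℚ) ≡⟨ fin (b ℕ.≤? n) ⟩
  (if b ℕ.+ c ℕ.≡ᵇ n then W b * (X * Y) else 0ℚ) ∎
  where
  open ≡-Reasoning
  R : ℕ → ℚ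
  R j = if c ℕ.≡ᵇ n ℕ.∸ j then Y else 0ℚ
  pt : ∀ j t → W j * ((if t then X else 0ℚ) * R j) ≡ (if t then W j * (X * R j) else 0ℚ)
  pt j true = refl
  pt j false = trans (cong (W j *_) (ℚP.*-zeroˡ (R j))) (ℚP.*-zeroʳ (W j))
  fin : Dec (b ℕ.≤ n) → (if b ℕ.<ᵇ suc n then W b * (X * R b) else 0ℚ) ≡ (if b ℕ.+ c ℕ.≡ᵇ n then W b * (X * Y) else 0ℚ)
  fin (yes p) rewrite <⇒<ᵇ≡true (ℕ.s≤s p) | +≡ᵇ-shift b c n p with c ℕ.≡ᵇ n ℕ.∸ b
  ... | true = refl
  ... | false = trans (cong (W b *_) (ℚP.*-zeroʳ X)) (ℚP.*-zeroʳ (W b))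
  fin (no p) rewrite ≮⇒<ᵇ≡false (λ q → p (ℕP.≤-pred q)) | +≡ᵇ-over b c n (ℕP.≰⇒> p) = refl

∑-convolution-delta-suc : ∀ k b c (W : ℕ → ℚ) (X : ℚ) (Y : ℚ) →
  ∑ (upTo (suc k)) (λ j → W j * ((if b ℕ.≡ᵇ suc j then X else 0ℚ) * (if c ℕ.≡ᵇ k ℕ.∸ j then Y else 0ℚ)))
  ≡ (if b ℕ.≡ᵇ 0 then 0ℚ else (if b ℕ.+ c ℕ.≡ᵇ suc k then W (b ℕ.∸ 1) * (X * Y) else 0ℚ))
∑-convolution-delta-suc k zero c W X Y =
  ∑-vanishes (upTo (suc k)) (λ j → trans (cong (W j *_) (ℚP.*-zeroˡ (if c ℕ.≡ᵇ k ℕ.∸ j then Y else 0ℚ))) (ℚP.*-zeroʳ (W j)))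
∑-convolution-delta-suc k (suc b) c W X Y = ∑-convolution-delta k b c W X Y

binom2 : ℕ → ℚ
binom2 zero = 1ℚ
binom2 (suc zero) = fromℕ 2
binom2 (suc (suc zero)) = 1ℚ
binom2 (suc (suc (suc _))) = 0ℚ

∑-coord-e : ∀ a → ∑ (upTo (suc a)) (λ b → sgn b * (if a ℕ.∸ b ℕ.≤ᵇ 1 then 1ℚ else 0ℚ)) ≡ (if a ℕ.≡ᵇ 0 then 1ℚ else 0ℚ)
∑-coord-e zero = refl
∑-coord-e (suc zero) = refl
∑-coord-e (suc (suc m)) = begin
  ∑ (upTo (suc (suc (suc m)))) φ ≡⟨ ∑-upTo-last3 m φ z ⟩
  φ m + (φ (suc m) + φ (suc (suc m)))
    ≡⟨ cong₂ (λ u v → φ m + (u + v)) (cong (λ x → x * (if suc (suc m) ℕ.∸ suc m ℕ.≤ᵇ 1 then 1ℚ else 0ℚ)) (sgn-suc m))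
                                     (cong (λ x → x * (if suc (suc m) ℕ.∸ suc (suc m) ℕ.≤ᵇ 1 then 1ℚ else 0ℚ)) (sgn-suc-suc m)) ⟩
  sgn m * I (suc (suc m) ℕ.∸ m) + ((- sgn m) * I (suc (suc m) ℕ.∸ suc m) + sgn m * I (suc (suc m) ℕ.∸ suc (suc m)))
    ≡⟨ cong₂ (λ u v → sgn m * I u + ((- sgn m) * I (suc (suc m) ℕ.∸ suc m) + sgn m * I v)) (ℕP.m+n∸n≡m 2 m) (ℕP.n∸n≡0 (suc (suc m))) ⟩
  sgn m * 0ℚ + ((- sgn m) * I (suc (suc m) ℕ.∸ suc m) + sgn m * 1ℚ) ≡⟨ cong (λ u → sgn m * 0ℚ + ((- sgn m) * I u + sgn m * 1ℚ)) (ℕP.m+n∸n≡m 1 m) ⟩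
  sgn m * 0ℚ + ((- sgn m) * 1ℚ + sgn m * 1ℚ) ≡⟨ solve 1 (λ s → s :* con 0ℚ :+ ((:- s) :* con 1ℚ :+ s :* con 1ℚ) := con 0ℚ) refl (sgn m) ⟩
  0ℚ ∎
  where
  open ≡-Reasoning
  I : ℕ → ℚ
  I x = if x ℕ.≤ᵇ 1 then 1ℚ else 0ℚ
  φ : ℕ → ℚ
  φ b = sgn b * I (suc (suc m) ℕ.∸ b)
  z : ∀ b → b ℕ.< m → φ b ≡ 0ℚ
  z b p = trans (cong (λ x → sgn b * I x) ([2+m]∸b≡3+[m∸1+b] p)) (ℚP.*-zeroʳ (sgn b))

-- For a ≥ 2 the alternating sums against binom2 are second differences, so they kill affine weights.
∑-alternating-binom2 : ∀ m (f : ℕ → ℚ) →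
  ∑ (upTo (suc (suc (suc m)))) (λ b → sgn b * (binom2 (suc (suc m) ℕ.∸ b) * f b))
    ≡ sgn m * (f m + (- (fromℕ 2 * f (suc m)) + f (suc (suc m))))
∑-alternating-binom2 m f = begin
  ∑ (upTo (suc (suc (suc m)))) φ ≡⟨ ∑-upTo-last3 m φ vanish ⟩
  φ m + (φ (suc m) + φ (suc (suc m)))
    ≡⟨ cong₂ (λ u v → u + v)
         (cong (λ t → sgn m * (binom2 t * f m)) (ℕP.m+n∸n≡m 2 m))
         (cong₂ _+_ (cong₂ (λ σ t → σ * (binom2 t * f (suc m))) (sgn-suc m) (ℕP.m+n∸n≡m 1 (suc m)))
                    (cong₂ (λ σ t → σ * (binom2 t * f (suc (suc m)))) (sgn-suc-suc m) (ℕP.n∸n≡0 (suc (suc m))))) ⟩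
  sgn m * (1ℚ * f m) + ((- sgn m) * (fromℕ 2 * f (suc m)) + sgn m * (1ℚ * f (suc (suc m))))
    ≡⟨ solve 5 (λ σ c x y z → σ :* (con 1ℚ :* x) :+ ((:- σ) :* (c :* y) :+ σ :* (con 1ℚ :* z))
                              := σ :* (x :+ ((:- (c :* y)) :+ z))) refl (sgn m) (fromℕ 2) (f m) (f (suc m)) (f (suc (suc m))) ⟩
  sgn m * (f m + (- (fromℕ 2 * f (suc m)) + f (suc (suc m)))) ∎
  where
  open ≡-Reasoning
  φ : ℕ → ℚ
  φ b = sgn b * (binom2 (suc (suc m) ℕ.∸ b) * f b)
  vanish : ∀ b → b ℕ.< m → φ b ≡ 0ℚ
  vanish b b<m = trans (cong (λ t → sgn b * (binom2 t * f b)) ([2+m]∸b≡3+[m∸1+b] b<m))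
                       (trans (cong (sgn b *_) (ℚP.*-zeroˡ (f b))) (ℚP.*-zeroʳ (sgn b)))

second-difference-affine : ∀ σ y → σ * (y + (- (fromℕ 2 * (1ℚ + y)) + (1ℚ + (1ℚ + y)))) ≡ 0ℚ
second-difference-affine σ y = trans (cong (λ c → σ * (y + (- (c * (1ℚ + y)) + (1ℚ + (1ℚ + y))))) fromℕ-2)
  (solve 2 (λ σ y → σ :* (y :+ ((:- ((con 1ℚ :+ con 1ℚ) :* (con 1ℚ :+ y))) :+ (con 1ℚ :+ (con 1ℚ :+ y)))) := con 0ℚ) refl σ y)

∑-coord-weightedE² : ∀ a → ∑ (upTo (suc a)) (λ b → sgn b * (binom2 (a ℕ.∸ b) * fromℕ (a ℕ.+ b))) ≡ 0ℚ
∑-coord-weightedE² zero = refl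
∑-coord-weightedE² (suc zero) = refl
∑-coord-weightedE² (suc (suc m)) = begin
  ∑ (upTo (suc (suc (suc m)))) (λ b → sgn b * (binom2 (a ℕ.∸ b) * fromℕ (a ℕ.+ b)))
    ≡⟨ ∑-alternating-binom2 m (λ b → fromℕ (a ℕ.+ b)) ⟩
  sgn m * (y + (- (fromℕ 2 * fromℕ (a ℕ.+ suc m)) + fromℕ (a ℕ.+ a)))
    ≡⟨ cong₂ (λ u v → sgn m * (y + (- (fromℕ 2 * u) + v)))
         (trans (cong fromℕ (ℕP.+-suc a m)) (fromℕ-suc (a ℕ.+ m)))
         (trans (cong fromℕ (trans (ℕP.+-suc a (suc m)) (cong suc (ℕP.+-suc a m)))) (fromℕ-2+ (a ℕ.+ m))) ⟩
  sgn m * (y + (- (fromℕ 2 * (1ℚ + y)) + (1ℚ + (1ℚ + y)))) ≡⟨ second-difference-affine (sgn m) y ⟩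
  0ℚ ∎
  where
  open ≡-Reasoning
  a = suc (suc m)
  y = fromℕ (a ℕ.+ m)

fermionFactor : Bool → ℕ → ℚ
fermionFactor s b = if s then fromℕ (suc b) else 1ℚ

coordTerm-et : Bool → ℕ → ℕ → ℚ
coordTerm-et s a b = sgn b * (binom2 (a ℕ.∸ b) * fermionFactor s b)

coordValue-et : Bool → ℕ → ℚ
coordValue-et true a = if a ℕ.≡ᵇ 0 then 1ℚ else 0ℚ
coordValue-et false a = if a ℕ.≤ᵇ 1 then 1ℚ else 0ℚ

∑-coord-et : ∀ s a → ∑ (upTo (suc a)) (coordTerm-et s a) ≡ coordValue-et s a
∑-coord-et true zero = refl
∑-coord-et false zero = refl
∑-coord-et true (suc zero) = refl
∑-coord-et false (suc zero) = refl
∑-coord-et true (suc (suc m)) = begin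
  ∑ (upTo (suc (suc (suc m)))) (coordTerm-et true (suc (suc m))) ≡⟨ ∑-alternating-binom2 m (λ b → fromℕ (suc b)) ⟩
  sgn m * (y + (- (fromℕ 2 * fromℕ (suc (suc m))) + fromℕ (suc (suc (suc m)))))
    ≡⟨ cong₂ (λ u v → sgn m * (y + (- (fromℕ 2 * u) + v))) (fromℕ-suc (suc m)) (fromℕ-2+ (suc m)) ⟩
  sgn m * (y + (- (fromℕ 2 * (1ℚ + y)) + (1ℚ + (1ℚ + y)))) ≡⟨ second-difference-affine (sgn m) y ⟩
  0ℚ ∎
  where
  open ≡-Reasoning
  y = fromℕ (suc m)
∑-coord-et false (suc (suc m)) = trans (∑-alternating-binom2 m (λ _ → 1ℚ))
  (trans (cong (λ c → sgn m * (1ℚ + (- (c * 1ℚ) + 1ℚ))) fromℕ-2)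
         (solve 1 (λ σ → σ :* (con 1ℚ :+ ((:- ((con 1ℚ :+ con 1ℚ) :* con 1ℚ)) :+ con 1ℚ)) := con 0ℚ) refl (sgn m)))

∏coords : ∀ {N} → (Bool → ℕ → ℕ → ℚ) → Vec Bool N → Vec ℕ N → Vec ℕ N → ℚ
∏coords φ [] [] [] = 1ℚ
∏coords φ (s ∷ S) (a ∷ α) (b ∷ β) = φ s a b * ∏coords φ S α β

∏coords′ : ∀ {N} → (Bool → ℕ → ℚ) → Vec Bool N → Vec ℕ N → ℚ
∏coords′ ψ [] [] = 1ℚ
∏coords′ ψ (s ∷ S) (a ∷ α) = ψ s a * ∏coords′ ψ S α

∑-below-∏coords : ∀ {N} (φ : Bool → ℕ → ℕ → ℚ) (S : Vec Bool N) (α : Vec ℕ N) →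
  ∑ (below α) (∏coords φ S α) ≡ ∏coords′ (λ s a → ∑ (upTo (suc a)) (φ s a)) S α
∑-below-∏coords φ [] [] = ℚP.+-identityʳ 1ℚ
∑-below-∏coords φ (s ∷ S) (a ∷ α) = begin
  ∑ (below (a ∷ α)) (∏coords φ (s ∷ S) (a ∷ α)) ≡⟨ ∑-below-∷ a α (∏coords φ (s ∷ S) (a ∷ α)) ⟩
  ∑ (upTo (suc a)) (λ b → ∑ (below α) (λ β → φ s a b * ∏coords φ S α β))
     ≡⟨ ∑-cong (upTo (suc a)) (λ b → ∑-*ˡ (below α) (φ s a b) (∏coords φ S α)) ⟩
  ∑ (upTo (suc a)) (λ b → φ s a b * ∑ (below α) (∏coords φ S α)) ≡⟨ ∑-*ʳ (upTo (suc a)) (∑ (below α) (∏coords φ S α)) (φ s a) ⟩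
  ∑ (upTo (suc a)) (φ s a) * ∑ (below α) (∏coords φ S α) ≡⟨ cong (∑ (upTo (suc a)) (φ s a) *_) (∑-below-∏coords φ S α) ⟩
  ∑ (upTo (suc a)) (φ s a) * ∏coords′ (λ s a → ∑ (upTo (suc a)) (φ s a)) S α ∎
  where open ≡-Reasoning

coordTerm-e : Bool → ℕ → ℕ → ℚ
coordTerm-e _ a b = sgn b * 𝟙 (a ℕ.∸ b ℕ.≤ᵇ 1)

term-e-∏coords : ∀ {N} (α β : Vec ℕ N) → sgn (sumV β) * 𝟙 (allLe1 (vsub α β)) ≡ ∏coords coordTerm-e allFalse α β
term-e-∏coords [] [] = refl
term-e-∏coords (a ∷ α) (b ∷ β) = begin
  sgn (b ℕ.+ sumV β) * 𝟙 ((a ℕ.∸ b ℕ.≤ᵇ 1) ∧ allLe1 (vsub α β)) ≡⟨ cong₂ _*_ (sgn-+ b (sumV β)) (𝟙-∧ (a ℕ.∸ b ℕ.≤ᵇ 1) (allLe1 (vsub α β))) ⟩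
  (sgn b * sgn (sumV β)) * (𝟙 (a ℕ.∸ b ℕ.≤ᵇ 1) * 𝟙 (allLe1 (vsub α β)))
    ≡⟨ solve 4 (λ p q r t → (p :* q) :* (r :* t) := (p :* r) :* (q :* t)) refl (sgn b) (sgn (sumV β)) (𝟙 (a ℕ.∸ b ℕ.≤ᵇ 1)) (𝟙 (allLe1 (vsub α β))) ⟩
  coordTerm-e false a b * (sgn (sumV β) * 𝟙 (allLe1 (vsub α β))) ≡⟨ cong (coordTerm-e false a b *_) (term-e-∏coords α β) ⟩
  coordTerm-e false a b * ∏coords coordTerm-e allFalse α β ∎
  where open ≡-Reasoning

∏coords-e : ∀ {N} (α : Vec ℕ N) → ∏coords′ (λ s a → ∑ (upTo (suc a)) (coordTerm-e s a)) allFalse α ≡ 𝟙 (allZero α)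
∏coords-e [] = refl
∏coords-e (a ∷ α) = trans (cong₂ _*_ (∑-coord-e a) (∏coords-e α)) (sym (𝟙-∧ (a ℕ.≡ᵇ 0) (allZero α)))

∑-below-e : ∀ {N} (α : Vec ℕ N) → ∑ (below α) (λ β → sgn (sumV β) * 𝟙 (allLe1 (vsub α β))) ≡ 𝟙 (allZero α)
∑-below-e α = trans (∑-cong (below α) (term-e-∏coords α)) (trans (∑-below-∏coords coordTerm-e allFalse α) (∏coords-e α))

binom2ᵥ : ∀ {N} → Vec ℕ N → ℚ
binom2ᵥ [] = 1ℚ
binom2ᵥ (a ∷ α) = binom2 a * binom2ᵥ α

∑-below-weightedE² : ∀ {N} (α : Vec ℕ N) → ∑ (below α) (λ β → sgn (sumV β) * (fromℕ (sumV α ℕ.+ sumV β) * binom2ᵥ (vsub α β))) ≡ 0ℚ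
∑-below-weightedE² [] = refl
∑-below-weightedE² (a ∷ α) = begin
  ∑ (below (a ∷ α)) (λ β → sgn (sumV β) * (fromℕ (sumV (a ∷ α) ℕ.+ sumV β) * binom2ᵥ (vsub (a ∷ α) β)))
    ≡⟨ ∑-below-∷ a α (λ β → sgn (sumV β) * (fromℕ (sumV (a ∷ α) ℕ.+ sumV β) * binom2ᵥ (vsub (a ∷ α) β))) ⟩
  ∑ (upTo (suc a)) (λ b → ∑ (below α) (λ β → sgn (b ℕ.+ sumV β) * (fromℕ ((a ℕ.+ sumV α) ℕ.+ (b ℕ.+ sumV β)) * (binom2 (a ℕ.∸ b) * binom2ᵥ (vsub α β)))))
    ≡⟨ ∑-cong (upTo (suc a)) (λ b → ∑-cong (below α) (λ β → pt b β)) ⟩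
  ∑ (upTo (suc a)) (λ b → ∑ (below α) (λ β → X b * P β + Y b * Z β))
    ≡⟨ ∑-cong (upTo (suc a)) (λ b → trans (∑-+ (below α) (λ β → X b * P β) (λ β → Y b * Z β))
          (cong₂ _+_ (∑-*ˡ (below α) (X b) P) (trans (∑-*ˡ (below α) (Y b) Z) (trans (cong (Y b *_) (∑-below-weightedE² α)) (ℚP.*-zeroʳ (Y b)))))) ⟩
  ∑ (upTo (suc a)) (λ b → X b * ∑ (below α) P + 0ℚ)
    ≡⟨ ∑-cong (upTo (suc a)) (λ b → ℚP.+-identityʳ (X b * ∑ (below α) P)) ⟩
  ∑ (upTo (suc a)) (λ b → X b * ∑ (below α) P) ≡⟨ ∑-*ʳ (upTo (suc a)) (∑ (below α) P) X ⟩
  ∑ (upTo (suc a)) X * ∑ (below α) P ≡⟨ cong (_* ∑ (below α) P) (∑-coord-weightedE² a) ⟩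
  0ℚ * ∑ (below α) P ≡⟨ ℚP.*-zeroˡ (∑ (below α) P) ⟩
  0ℚ ∎
  where
  open ≡-Reasoning
  X : ℕ → ℚ
  X b = sgn b * (binom2 (a ℕ.∸ b) * fromℕ (a ℕ.+ b))
  Y : ℕ → ℚ
  Y b = sgn b * binom2 (a ℕ.∸ b)
  P : Vec ℕ _ → ℚ
  P β = sgn (sumV β) * binom2ᵥ (vsub α β)
  Z : Vec ℕ _ → ℚ
  Z β = sgn (sumV β) * (fromℕ (sumV α ℕ.+ sumV β) * binom2ᵥ (vsub α β))
  pt : ∀ b β → sgn (b ℕ.+ sumV β) * (fromℕ ((a ℕ.+ sumV α) ℕ.+ (b ℕ.+ sumV β)) * (binom2 (a ℕ.∸ b) * binom2ᵥ (vsub α β))) ≡ X b * P β + Y b * Z β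
  pt b β = begin
    sgn (b ℕ.+ sumV β) * (fromℕ ((a ℕ.+ sumV α) ℕ.+ (b ℕ.+ sumV β)) * (binom2 (a ℕ.∸ b) * binom2ᵥ (vsub α β)))
      ≡⟨ cong₂ (λ u v → u * (v * (binom2 (a ℕ.∸ b) * binom2ᵥ (vsub α β)))) (sgn-+ b (sumV β))
           (trans (cong fromℕ (interchange a (sumV α) b (sumV β))) (fromℕ-+ (a ℕ.+ b) (sumV α ℕ.+ sumV β))) ⟩
    (sgn b * sgn (sumV β)) * ((fromℕ (a ℕ.+ b) + fromℕ (sumV α ℕ.+ sumV β)) * (binom2 (a ℕ.∸ b) * binom2ᵥ (vsub α β)))
      ≡⟨ solve 6 (λ sb sB fab fAB c C → (sb :* sB) :* ((fab :+ fAB) :* (c :* C)) := (sb :* (c :* fab)) :* (sB :* C) :+ (sb :* c) :* (sB :* (fAB :* C))) refl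
           (sgn b) (sgn (sumV β)) (fromℕ (a ℕ.+ b)) (fromℕ (sumV α ℕ.+ sumV β)) (binom2 (a ℕ.∸ b)) (binom2ᵥ (vsub α β)) ⟩
    X b * P β + Y b * Z β ∎

fermionWeight : ∀ {N} → Vec Bool N → Vec ℕ N → ℚ
fermionWeight [] [] = 1ℚ
fermionWeight (s ∷ S) (b ∷ β) = fermionFactor s b * fermionWeight S β

fermionWeight-allFalse : ∀ {N} (β : Vec ℕ N) → fermionWeight allFalse β ≡ 1ℚ
fermionWeight-allFalse [] = refl
fermionWeight-allFalse (b ∷ β) = trans (ℚP.*-identityˡ (fermionWeight allFalse β)) (fermionWeight-allFalse β)

fermExp-fermionWeight : ∀ {N} (S : Vec Bool N) β → oneTrue S ≡ true → fromℕ (suc (fermExp β S)) ≡ fermionWeight S β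
fermExp-fermionWeight (true ∷ S) (b ∷ β) eq rewrite noneTrue⇒allFalse S eq =
  sym (trans (cong (fromℕ (suc b) *_) (fermionWeight-allFalse β)) (ℚP.*-identityʳ (fromℕ (suc b))))
fermExp-fermionWeight (false ∷ S) (b ∷ β) eq = trans (fermExp-fermionWeight S β eq) (sym (ℚP.*-identityˡ (fermionWeight S β)))

term-et-∏coords : ∀ {N} (S : Vec Bool N) α β → sgn (sumV β) * (fermionWeight S β * binom2ᵥ (vsub α β)) ≡ ∏coords coordTerm-et S α β
term-et-∏coords [] [] [] = refl
term-et-∏coords (s ∷ S) (a ∷ α) (b ∷ β) = begin
  sgn (b ℕ.+ sumV β) * ((w * fermionWeight S β) * (binom2 (a ℕ.∸ b) * binom2ᵥ (vsub α β)))
    ≡⟨ cong (_* ((w * fermionWeight S β) * (binom2 (a ℕ.∸ b) * binom2ᵥ (vsub α β)))) (sgn-+ b (sumV β)) ⟩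
  (sgn b * sgn (sumV β)) * ((w * fermionWeight S β) * (binom2 (a ℕ.∸ b) * binom2ᵥ (vsub α β)))
    ≡⟨ solve 6 (λ p q x y u v → (p :* q) :* ((x :* y) :* (u :* v)) := (p :* (u :* x)) :* (q :* (y :* v))) refl (sgn b) (sgn (sumV β)) w (fermionWeight S β) (binom2 (a ℕ.∸ b)) (binom2ᵥ (vsub α β)) ⟩
  coordTerm-et s a b * (sgn (sumV β) * (fermionWeight S β * binom2ᵥ (vsub α β))) ≡⟨ cong (coordTerm-et s a b *_) (term-et-∏coords S α β) ⟩
  coordTerm-et s a b * ∏coords coordTerm-et S α β ∎
  where
  open ≡-Reasoning
  w = fermionFactor s b

∑-below-et : ∀ {N} (S : Vec Bool N) (α : Vec ℕ N) → oneTrue S ≡ true →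
  ∑ (below α) (λ β → sgn (sumV β) * (fromℕ (suc (fermExp β S)) * binom2ᵥ (vsub α β))) ≡ ∏coords′ coordValue-et S α
∑-below-et S α eq = trans (∑-cong (below α) (λ β → trans (cong (λ u → sgn (sumV β) * (u * binom2ᵥ (vsub α β))) (fermExp-fermionWeight S β eq)) (term-et-∏coords S α β)))
  (trans (∑-below-∏coords coordTerm-et S α) (cong-prodAS S α))
  where
  cong-prodAS : ∀ {N} (S : Vec Bool N) α → ∏coords′ (λ s a → ∑ (upTo (suc a)) (coordTerm-et s a)) S α ≡ ∏coords′ coordValue-et S α
  cong-prodAS [] [] = refl
  cong-prodAS (s ∷ S) (a ∷ α) = cong₂ _*_ (∑-coord-et s a) (cong-prodAS S α)

∏coords-et-allFalse : ∀ {N} (α : Vec ℕ N) → ∏coords′ coordValue-et allFalse α ≡ 𝟙 (allLe1 α)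
∏coords-et-allFalse [] = refl
∏coords-et-allFalse (a ∷ α) = trans (cong (coordValue-et false a *_) (∏coords-et-allFalse α)) (sym (𝟙-∧ (a ℕ.≤ᵇ 1) (allLe1 α)))

∏coords-et : ∀ {N} (S : Vec Bool N) α → oneTrue S ≡ true → ∏coords′ coordValue-et S α ≡ 𝟙 (oneFermAtZero α S ∧ allLe1 α)
∏coords-et (true ∷ S) (a ∷ α) eq = trans (cong (coordValue-et true a *_) pa) (lem a)
  where
  pa : ∏coords′ coordValue-et S α ≡ 𝟙 (allLe1 α)
  pa = trans (cong (λ S' → ∏coords′ coordValue-et S' α) (noneTrue⇒allFalse S eq)) (∏coords-et-allFalse α)
  lem : ∀ a → coordValue-et true a * 𝟙 (allLe1 α) ≡ 𝟙 (((a ℕ.≡ᵇ 0) ∧ noneTrue S) ∧ ((a ℕ.≤ᵇ 1) ∧ allLe1 α))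
  lem zero rewrite eq = ℚP.*-identityˡ (𝟙 (allLe1 α))
  lem (suc a') = ℚP.*-zeroˡ (𝟙 (allLe1 α))
∏coords-et (false ∷ S) (a ∷ α) eq = trans (cong (coordValue-et false a *_) (∏coords-et S α eq)) (lem (a ℕ.≤ᵇ 1) (oneFermAtZero α S) (allLe1 α))
  where
  lem : ∀ p o q → 𝟙 p * 𝟙 (o ∧ q) ≡ 𝟙 (o ∧ (p ∧ q))
  lem true o q = ℚP.*-identityˡ (𝟙 (o ∧ q))
  lem false true q = ℚP.*-zeroˡ (𝟙 q)
  lem false false q = ℚP.*-zeroˡ 0ℚ

oneFermAtZero-notOne : ∀ {N} (α : Vec ℕ N) S → oneTrue S ≡ false → oneFermAtZero α S ≡ false
oneFermAtZero-notOne [] [] eq = refl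
oneFermAtZero-notOne (a ∷ α) (true ∷ S) eq rewrite eq = BP.∧-zeroʳ (a ℕ.≡ᵇ 0)
oneFermAtZero-notOne (a ∷ α) (false ∷ S) eq = oneFermAtZero-notOne α S eq

-- Three convolution identities

-- E² m is the degree-m part of ∏ᵢ (1 + xᵢ)², i.e. Σ_{a+b=m} e_a e_b.
E² : ∀ {N} → ℕ → SP N
E² m (α , S) = if noneTrue S ∧ (sumV α ℕ.≡ᵇ m) then binom2ᵥ α else 0ℚ

E²-bosonic : ∀ {N} m → Bosonic (E² {N} m)
E²-bosonic m α S p with noneTrue S
E²-bosonic m α S () | true
... | false = refl

h-bosonic : ∀ {N} n → Bosonic (h {N} n)
h-bosonic n α S p rewrite h-coeff n α S with noneTrue S
h-bosonic n α S () | true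
... | false = refl

e-bosonic : ∀ {N} n → Bosonic (e {N} n)
e-bosonic n α S p with noneTrue S
e-bosonic n α S () | true
... | false = refl

∑-below-split-zeros : ∀ {N} (α : Vec ℕ N) (V : Vec ℕ N → ℚ) →
  ∑ (below α) (λ β → (if allZero β then V β else 0ℚ) + - V β) ≡ V zeros + - ∑ (below α) V
∑-below-split-zeros α V = trans (∑-+ (below α) (λ β → if allZero β then V β else 0ℚ) (λ β → - V β))
  (cong₂ _+_ (∑-below-delta-zeros α V) (∑-neg (below α) V))

coeff-convolution : ∀ {N} (js : List ℕ) (w : ℕ → ℚ) (f g : ℕ → SP N) → (∀ j → Bosonic (g j)) → ∀ α S →
  sumSP (map (λ j → w j • (f j *sp g j)) js) (α , S) ≡
  ∑ (below α) (λ β → ∑ js (λ j → w j * (f j (β , S) * g j (vsub α β , allFalse))))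
coeff-convolution js w f g ev α S = begin
  sumSP (map (λ j → w j • (f j *sp g j)) js) (α , S) ≡⟨ sumSP-map js (λ j → w j • (f j *sp g j)) (α , S) ⟩
  ∑ js (λ j → w j * (f j *sp g j) (α , S)) ≡⟨ ∑-cong js (λ j → cong (w j *_) (*sp-bosonicʳ (f j) (g j) (ev j) α S)) ⟩
  ∑ js (λ j → w j * ∑ (below α) (λ β → f j (β , S) * g j (vsub α β , allFalse)))
    ≡⟨ ∑-cong js (λ j → sym (∑-*ˡ (below α) (w j) (λ β → f j (β , S) * g j (vsub α β , allFalse)))) ⟩
  ∑ js (λ j → ∑ (below α) (λ β → w j * (f j (β , S) * g j (vsub α β , allFalse)))) ≡⟨ ∑-swap js (below α) _ ⟩
  ∑ (below α) (λ β → ∑ js (λ j → w j * (f j (β , S) * g j (vsub α β , allFalse)))) ∎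
  where open ≡-Reasoning

E²-allFalse : ∀ {N} m (γ : Vec ℕ N) → E² m (γ , allFalse) ≡ (if sumV γ ℕ.≡ᵇ m then binom2ᵥ γ else 0ℚ)
E²-allFalse {N} m γ = cong (λ b → if b ∧ (sumV γ ℕ.≡ᵇ m) then binom2ᵥ γ else 0ℚ) (noneTrue-allFalse {N})

e-allFalse : ∀ {N} m (γ : Vec ℕ N) → e m (γ , allFalse) ≡ (if sumV γ ℕ.≡ᵇ m then 𝟙 (allLe1 γ) else 0ℚ)
e-allFalse {N} m γ = trans (cong (λ b → if b ∧ (allLe1 γ ∧ (sumV γ ℕ.≡ᵇ m)) then 1ℚ else 0ℚ) (noneTrue-allFalse {N})) (lem (allLe1 γ))
  where lem : ∀ x → (if x ∧ (sumV γ ℕ.≡ᵇ m) then 1ℚ else 0ℚ) ≡ (if sumV γ ℕ.≡ᵇ m then 𝟙 x else 0ℚ)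
        lem true = refl
        lem false = sym (if-0ℚ (sumV γ ℕ.≡ᵇ m))

et-convolution : ∀ {N} n → sumSP (map (λ j → sgn j • (ht j *sp E² (n ℕ.∸ j))) (upTo (suc n))) ≋ et {N} n
et-convolution {N} n (α , S) =
  trans (coeff-convolution (upTo (suc n)) sgn ht (λ j → E² (n ℕ.∸ j)) (λ j → E²-bosonic (n ℕ.∸ j)) α S) (go (oneTrue S) refl)
  where
  ht-coeff′ : ∀ {o} → oneTrue S ≡ o → ∀ j β → ht j (β , S) ≡ (if o ∧ (sumV β ℕ.≡ᵇ j) then fromℕ (suc (fermExp β S)) else 0ℚ)
  ht-coeff′ eq j β = trans (ht-coeff j β S) (cong (λ o → if o ∧ (sumV β ℕ.≡ᵇ j) then fromℕ (suc (fermExp β S)) else 0ℚ) eq)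
  term : Vec ℕ N → ℚ
  term β = sgn (sumV β) * (fromℕ (suc (fermExp β S)) * binom2ᵥ (vsub α β))
  go : ∀ o → oneTrue S ≡ o →
    ∑ (below α) (λ β → ∑ (upTo (suc n)) (λ j → sgn j * (ht j (β , S) * E² (n ℕ.∸ j) (vsub α β , allFalse)))) ≡ et n (α , S)
  go false eq = trans (∑∑-vanishes (below α) (upTo (suc n)) sgn _ _ (λ β j → ht-coeff′ eq j β))
    (sym (cong (λ o → if o ∧ (allLe1 α ∧ (sumV α ℕ.≡ᵇ n)) then 1ℚ else 0ℚ) (oneFermAtZero-notOne α S eq)))
  go true eq = begin
    ∑ (below α) (λ β → ∑ (upTo (suc n)) (λ j → sgn j * (ht j (β , S) * E² (n ℕ.∸ j) (vsub α β , allFalse))))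
      ≡⟨ ∑-below-cong α (λ β β≤α → trans
           (∑-cong (upTo (suc n)) (λ j → cong₂ (λ u v → sgn j * (u * v)) (ht-coeff′ eq j β) (E²-allFalse (n ℕ.∸ j) (vsub α β))))
           (trans (∑-convolution-delta n (sumV β) (sumV (vsub α β)) sgn (fromℕ (suc (fermExp β S))) (binom2ᵥ (vsub α β)))
                  (cong (λ m → if m ℕ.≡ᵇ n then term β else 0ℚ) (sumV-vsub β≤α)))) ⟩
    ∑ (below α) (λ β → if sumV α ℕ.≡ᵇ n then term β else 0ℚ) ≡⟨ last (sumV α ℕ.≡ᵇ n) ⟩
    et n (α , S) ∎
    where
    open ≡-Reasoning
    last : ∀ t → ∑ (below α) (λ β → if t then term β else 0ℚ) ≡ 𝟙 (oneFermAtZero α S ∧ (allLe1 α ∧ t))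
    last true = trans (∑-below-et S α eq) (trans (∏coords-et S α eq) (cong (λ z → 𝟙 (oneFermAtZero α S ∧ z)) (sym (BP.∧-identityʳ (allLe1 α)))))
    last false = trans (∑-zero (below α))
      (sym (cong 𝟙 (trans (cong (oneFermAtZero α S ∧_) (BP.∧-zeroʳ (allLe1 α))) (BP.∧-zeroʳ (oneFermAtZero α S)))))

sumV-zeros : ∀ {N} → sumV {N} zeros ≡ 0
sumV-zeros {zero} = refl
sumV-zeros {suc N} = sumV-zeros {N}

h-coeff-bosonic : ∀ {N} n (β : Vec ℕ N) S → noneTrue S ≡ true → h n (β , S) ≡ (if sumV β ℕ.≡ᵇ n then 1ℚ else 0ℚ)
h-coeff-bosonic n β S eq = trans (h-coeff n β S) (cong (λ o → if o ∧ (sumV β ℕ.≡ᵇ n) then 1ℚ else 0ℚ) eq)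

h-coeff-fermionic : ∀ {N} n (β : Vec ℕ N) S → noneTrue S ≡ false → h n (β , S) ≡ 0ℚ
h-coeff-fermionic n β S eq = trans (h-coeff n β S) (cong (λ o → if o ∧ (sumV β ℕ.≡ᵇ n) then 1ℚ else 0ℚ) eq)

-- Writing the term at β ≠ 0 as the difference of its value and of the full β-sum lets the
-- factorised sums ∑-below-e and ∑-below-weightedE² finish the two recurrences.
e-punctured : ∀ b t (I : ℚ) → (if b ℕ.≡ᵇ 0 then 0ℚ else (if t then sgn (b ℕ.∸ 1) * (1ℚ * I) else 0ℚ))
  ≡ (if b ℕ.≡ᵇ 0 then 𝟙 t * (sgn b * I) else 0ℚ) + - (𝟙 t * (sgn b * I))
e-punctured zero t I = sym (ℚP.+-inverseʳ (𝟙 t * (1ℚ * I)))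
e-punctured (suc b) true I = trans (solve 2 (λ s i → s :* (con 1ℚ :* i) := con 0ℚ :+ (:- (con 1ℚ :* ((:- s) :* i)))) refl (sgn b) I)
  (cong (λ z → 0ℚ + - (1ℚ * (z * I))) (sym (sgn-suc b)))
e-punctured (suc b) false I = solve 1 (λ x → con 0ℚ := con 0ℚ :+ (:- (con 0ℚ :* x))) refl (sgn (suc b) * I)

e-convolution : ∀ {N} k → sumSP (map (λ j → sgn j • (h (suc j) *sp e (k ℕ.∸ j))) (upTo (suc k))) ≋ e {N} (suc k)
e-convolution {N} k (α , S) =
  trans (coeff-convolution (upTo (suc k)) sgn (λ j → h (suc j)) (λ j → e (k ℕ.∸ j)) (λ j → e-bosonic (k ℕ.∸ j)) α S) (go (noneTrue S) refl)
  where
  t = sumV α ℕ.≡ᵇ suc k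
  V : Vec ℕ N → ℚ
  V β = 𝟙 t * (sgn (sumV β) * 𝟙 (allLe1 (vsub α β)))
  go : ∀ o → noneTrue S ≡ o →
    ∑ (below α) (λ β → ∑ (upTo (suc k)) (λ j → sgn j * (h (suc j) (β , S) * e (k ℕ.∸ j) (vsub α β , allFalse)))) ≡ e (suc k) (α , S)
  go false eq = trans (∑∑-vanishes (below α) (upTo (suc k)) sgn _ _ (λ β j → h-coeff-fermionic (suc j) β S eq))
    (sym (cong (λ o → if o ∧ (allLe1 α ∧ t) then 1ℚ else 0ℚ) eq))
  go true eq = begin
    ∑ (below α) (λ β → ∑ (upTo (suc k)) (λ j → sgn j * (h (suc j) (β , S) * e (k ℕ.∸ j) (vsub α β , allFalse))))
      ≡⟨ ∑-below-cong α (λ β β≤α → trans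
           (∑-cong (upTo (suc k)) (λ j → cong₂ (λ u v → sgn j * (u * v)) (h-coeff-bosonic (suc j) β S eq) (e-allFalse (k ℕ.∸ j) (vsub α β))))
           (trans (∑-convolution-delta-suc k (sumV β) (sumV (vsub α β)) sgn 1ℚ (𝟙 (allLe1 (vsub α β))))
           (trans (cong (λ m → if sumV β ℕ.≡ᵇ 0 then 0ℚ else (if m ℕ.≡ᵇ suc k then sgn (sumV β ℕ.∸ 1) * (1ℚ * 𝟙 (allLe1 (vsub α β))) else 0ℚ))
                        (sumV-vsub β≤α))
           (trans (e-punctured (sumV β) t (𝟙 (allLe1 (vsub α β)))) (cong (λ z → (if z then V β else 0ℚ) + - V β) (sym (allZero≡sumV≡ᵇ0 β))))))) ⟩
    ∑ (below α) (λ β → (if allZero β then V β else 0ℚ) + - V β) ≡⟨ ∑-below-split-zeros α V ⟩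
    V zeros + - ∑ (below α) V
      ≡⟨ cong₂ (λ u v → u + - v) (cong₂ (λ u v → 𝟙 t * (sgn u * 𝟙 (allLe1 v))) (sumV-zeros {N}) (vsub-zeros α))
                                 (trans (∑-*ˡ (below α) (𝟙 t) _) (cong (𝟙 t *_) (∑-below-e α))) ⟩
    𝟙 t * (1ℚ * 𝟙 (allLe1 α)) + - (𝟙 t * 𝟙 (allZero α)) ≡⟨ last t refl ⟩
    e (suc k) (α , S) ∎
    where
    open ≡-Reasoning
    last : ∀ t′ → t ≡ t′ → 𝟙 t′ * (1ℚ * 𝟙 (allLe1 α)) + - (𝟙 t′ * 𝟙 (allZero α)) ≡ e (suc k) (α , S)
    last false e rewrite eq | e =
      trans (solve 2 (λ x y → con 0ℚ :* (con 1ℚ :* x) :+ (:- (con 0ℚ :* y)) := con 0ℚ) refl (𝟙 (allLe1 α)) (𝟙 (allZero α)))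
      (cong 𝟙 (sym (BP.∧-zeroʳ (allLe1 α))))
    last true e rewrite eq | e | allZero≡sumV≡ᵇ0 α | ≡ᵇ≡true⇒≡ {sumV α} e =
      trans (solve 1 (λ x → con 1ℚ :* (con 1ℚ :* x) :+ (:- (con 1ℚ :* con 0ℚ)) := x) refl (𝟙 (allLe1 α)))
            (cong 𝟙 (sym (BP.∧-identityʳ (allLe1 α))))

E²-weight : ℕ → ℕ → ℚ
E²-weight k t = sgn t * fromℕ (suc k ℕ.+ 1 ℕ.+ t)

E²-punctured : ∀ k a b t → (a ℕ.≡ᵇ suc k) ≡ t → ∀ C →
  (if b ℕ.≡ᵇ 0 then 0ℚ else (if t then E²-weight k (b ℕ.∸ 1) * (1ℚ * C) else 0ℚ))
    ≡ (if b ℕ.≡ᵇ 0 then 𝟙 t * (sgn b * (fromℕ (a ℕ.+ b) * C)) else 0ℚ) + - (𝟙 t * (sgn b * (fromℕ (a ℕ.+ b) * C)))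
E²-punctured k a zero t _ C = sym (ℚP.+-inverseʳ (𝟙 t * (1ℚ * (fromℕ (a ℕ.+ 0) * C))))
E²-punctured k a (suc b) true a≡1+k C = begin
  sgn b * fromℕ (suc k ℕ.+ 1 ℕ.+ b) * (1ℚ * C)
    ≡⟨ cong (λ z → sgn b * fromℕ z * (1ℚ * C)) (trans (ℕP.+-assoc (suc k) 1 b) (cong (ℕ._+ suc b) (sym (≡ᵇ≡true⇒≡ {a} {suc k} a≡1+k)))) ⟩
  sgn b * fromℕ (a ℕ.+ suc b) * (1ℚ * C)
    ≡⟨ solve 3 (λ s f c → s :* f :* (con 1ℚ :* c) := con 0ℚ :+ (:- (con 1ℚ :* ((:- s) :* (f :* c))))) refl (sgn b) (fromℕ (a ℕ.+ suc b)) C ⟩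
  0ℚ + - (1ℚ * ((- sgn b) * (fromℕ (a ℕ.+ suc b) * C))) ≡⟨ cong (λ z → 0ℚ + - (1ℚ * (z * (fromℕ (a ℕ.+ suc b) * C)))) (sym (sgn-suc b)) ⟩
  0ℚ + - (1ℚ * (sgn (suc b) * (fromℕ (a ℕ.+ suc b) * C))) ∎
  where open ≡-Reasoning
E²-punctured k a (suc b) false _ C = solve 1 (λ x → con 0ℚ := con 0ℚ :+ (:- (con 0ℚ :* x))) refl (sgn (suc b) * (fromℕ (a ℕ.+ suc b) * C))

E²-convolution : ∀ {N} k →
  sumSP (map (λ t → E²-weight k t • (h (suc t) *sp E² (k ℕ.∸ t))) (upTo (suc k))) ≋ (fromℕ (suc k) • E² {N} (suc k))
E²-convolution {N} k (α , S) =
  trans (coeff-convolution (upTo (suc k)) (E²-weight k) (λ j → h (suc j)) (λ j → E² (k ℕ.∸ j)) (λ j → E²-bosonic (k ℕ.∸ j)) α S) (go (noneTrue S) refl)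
  where
  a = sumV α
  t = a ℕ.≡ᵇ suc k
  V : Vec ℕ N → ℚ
  V β = 𝟙 t * (sgn (sumV β) * (fromℕ (a ℕ.+ sumV β) * binom2ᵥ (vsub α β)))
  go : ∀ o → noneTrue S ≡ o →
    ∑ (below α) (λ β → ∑ (upTo (suc k)) (λ j → E²-weight k j * (h (suc j) (β , S) * E² (k ℕ.∸ j) (vsub α β , allFalse))))
      ≡ (fromℕ (suc k) • E² (suc k)) (α , S)
  go false eq = trans (∑∑-vanishes (below α) (upTo (suc k)) (E²-weight k) _ _ (λ β j → h-coeff-fermionic (suc j) β S eq))
    (sym (trans (cong (λ o → fromℕ (suc k) * (if o ∧ t then binom2ᵥ α else 0ℚ)) eq) (ℚP.*-zeroʳ (fromℕ (suc k)))))
  go true eq = begin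
    ∑ (below α) (λ β → ∑ (upTo (suc k)) (λ j → E²-weight k j * (h (suc j) (β , S) * E² (k ℕ.∸ j) (vsub α β , allFalse))))
      ≡⟨ ∑-below-cong α (λ β β≤α → trans
           (∑-cong (upTo (suc k)) (λ j → cong₂ (λ u v → E²-weight k j * (u * v)) (h-coeff-bosonic (suc j) β S eq) (E²-allFalse (k ℕ.∸ j) (vsub α β))))
           (trans (∑-convolution-delta-suc k (sumV β) (sumV (vsub α β)) (E²-weight k) 1ℚ (binom2ᵥ (vsub α β)))
           (trans (cong (λ m → if sumV β ℕ.≡ᵇ 0 then 0ℚ else (if m ℕ.≡ᵇ suc k then E²-weight k (sumV β ℕ.∸ 1) * (1ℚ * binom2ᵥ (vsub α β)) else 0ℚ))
                        (sumV-vsub β≤α))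
           (trans (E²-punctured k a (sumV β) t refl (binom2ᵥ (vsub α β))) (cong (λ z → (if z then V β else 0ℚ) + - V β) (sym (allZero≡sumV≡ᵇ0 β))))))) ⟩
    ∑ (below α) (λ β → (if allZero β then V β else 0ℚ) + - V β) ≡⟨ ∑-below-split-zeros α V ⟩
    V zeros + - ∑ (below α) V
      ≡⟨ cong₂ (λ u v → u + - v) (cong₂ (λ u v → 𝟙 t * (sgn u * (fromℕ (a ℕ.+ u) * binom2ᵥ v))) (sumV-zeros {N}) (vsub-zeros α))
                                 (trans (∑-*ˡ (below α) (𝟙 t) _) (trans (cong (𝟙 t *_) (∑-below-weightedE² α)) (ℚP.*-zeroʳ (𝟙 t)))) ⟩
    𝟙 t * (1ℚ * (fromℕ (a ℕ.+ 0) * binom2ᵥ α)) + - 0ℚ ≡⟨ last t refl ⟩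
    (fromℕ (suc k) • E² (suc k)) (α , S) ∎
    where
    open ≡-Reasoning
    last : ∀ t′ → t ≡ t′ → 𝟙 t′ * (1ℚ * (fromℕ (a ℕ.+ 0) * binom2ᵥ α)) + - 0ℚ ≡ fromℕ (suc k) * (if noneTrue S ∧ t′ then binom2ᵥ α else 0ℚ)
    last true e rewrite eq = trans (cong (λ z → 1ℚ * (1ℚ * (fromℕ z * binom2ᵥ α)) + - 0ℚ) (trans (ℕP.+-identityʳ a) (≡ᵇ≡true⇒≡ e)))
      (solve 2 (λ f c → con 1ℚ :* (con 1ℚ :* (f :* c)) :+ (:- con 0ℚ) := f :* c) refl (fromℕ (suc k)) (binom2ᵥ α))
    last false e rewrite eq = solve 3 (λ f g c → con 0ℚ :* (con 1ℚ :* (f :* c)) :+ (:- con 0ℚ) := g :* con 0ℚ) refl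
      (fromℕ (a ℕ.+ 0)) (fromℕ (suc k)) (binom2ᵥ α)

h0≋1 : ∀ {N} → h {N} 0 ≋ (1ℚ • 1sp)
h0≋1 (α , S) = trans (h-coeff 0 α S) (trans (cong (λ z → if noneTrue S ∧ z then 1ℚ else 0ℚ) (sym (allZero≡sumV≡ᵇ0 α)))
   (trans (cong 𝟙 (BP.∧-comm (noneTrue S) (allZero α))) (sym (ℚP.*-identityˡ (1sp (α , S))))))

prodUpTo-1 : ∀ j → prodUpTo (λ _ → 1ℚ) j ≡ 1ℚ
prodUpTo-1 zero = refl
prodUpTo-1 (suc j) = trans (ℚP.*-identityˡ _) (prodUpTo-1 j)

eEntry : ∀ {N} → ℕ → ℕ → SP N
eEntry r c = if r ℕ.≤ᵇ suc c then h (suc c ℕ.∸ r) else 0sp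

eEntry-dropCorners : ∀ {N} j r c → dropCorners j (eEntry {N}) r c ≡ eEntry r c
eEntry-dropCorners j r c =
  trans (dropCorners≡ j eEntry r c) (trans (cong (λ b → if b then h (suc (c ℕ.+ j) ℕ.∸ (r ℕ.+ j)) else 0sp) (≤ᵇ-+ʳ r (suc c) j))
   (cong (λ z → if r ℕ.≤ᵇ suc c then h z else 0sp) ([m+o]∸[n+o]≡m∸n (suc c) r j)))

eEntry-zero : ∀ {N} → ZeroBelowSubdiagonal (eEntry {N})
eEntry-zero r c p rewrite ≰⇒≤ᵇ≡false {r} {suc c} (λ q → ℕP.<⇒≱ p q) = λ μ → refl

eEntry-subdiagonal : ∀ {N} → ScalarSubdiagonal (eEntry {N}) (λ _ → 1ℚ)
eEntry-subdiagonal r μ rewrite ≤⇒≤ᵇ≡true (ℕP.≤-refl {suc r}) | ℕP.n∸n≡0 r = h0≋1 μ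

eEntry-bosonic : ∀ {N} → BosonicBelowFirstRow (eEntry {N})
eEntry-bosonic r c = bosonic-if (suc r ℕ.≤ᵇ suc c) (h (suc c ℕ.∸ suc r)) (h-bosonic (suc c ℕ.∸ suc r))

1≋e0 : ∀ {N} → 1sp ≋ e {N} 0
1≋e0 (α , S) = trans (cong (λ z → if z ∧ noneTrue S then 1ℚ else 0ℚ) (allZero≡sumV≡ᵇ0 α)) (lem (sumV α ℕ.≡ᵇ 0) (noneTrue S) (allLe1-0 α))
  where
  allLe1-0 : ∀ {N} (α : Vec ℕ N) → (sumV α ℕ.≡ᵇ 0) ≡ true → allLe1 α ≡ true
  allLe1-0 [] p = refl
  allLe1-0 (zero ∷ α) p = allLe1-0 α p
  lem : ∀ z s → (z ≡ true → allLe1 α ≡ true) → (if z ∧ s then 1ℚ else 0ℚ) ≡ (if s ∧ (allLe1 α ∧ z) then 1ℚ else 0ℚ)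
  lem true true p rewrite p refl = refl
  lem true false p = refl
  lem false true p = cong 𝟙 (sym (BP.∧-zeroʳ (allLe1 α)))
  lem false false p = refl

det-eMatrix : ∀ {N} n m → m ℕ.≤ n → det (EMat N m) ≋ e m
det-eMatrix n zero _ = 1≋e0
det-eMatrix (suc n) (suc k) (ℕ.s≤s k≤n) = begin
  det (EMat _ (suc k)) ≈⟨ det-hessenberg k eEntry (λ _ → 1ℚ) eEntry-zero eEntry-subdiagonal eEntry-bosonic ⟩
  sumSP (map (hessenbergTerm k eEntry (λ _ → 1ℚ)) (upTo (suc k)))
    ≈⟨ sumSP-cong (upTo (suc k)) (hessenbergTerm k eEntry (λ _ → 1ℚ)) (λ j → sgn j • (h (suc j) *sp e (k ℕ.∸ j))) term≋ ⟩
  sumSP (map (λ j → sgn j • (h (suc j) *sp e (k ℕ.∸ j))) (upTo (suc k))) ≈⟨ e-convolution k ⟩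
  e (suc k) ∎
  where
  open import Relation.Binary.Reasoning.Setoid (≋-setoid _)
  term≋ : ∀ j → hessenbergTerm k eEntry (λ _ → 1ℚ) j ≋ (sgn j • (h (suc j) *sp e (k ℕ.∸ j)))
  term≋ j = •-cong (sgn j) (*sp-cong (≋-refl {f = h (suc j)})
     (≋-trans (•-cong (prodUpTo (λ _ → 1ℚ) j) (≋-trans (det-cong _ (EMat _ (k ℕ.∸ j)) (λ r c μ → cong (λ f → f μ) (eEntry-dropCorners (suc j) (toℕ r) (toℕ c))))
                                                    (det-eMatrix n (k ℕ.∸ j) (ℕP.≤-trans (ℕP.m∸n≤m k j) k≤n))))
     (λ μ → trans (cong (_* e (k ℕ.∸ j) μ) (prodUpTo-1 j)) (ℚP.*-identityˡ (e (k ℕ.∸ j) μ)))))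

etEntry : ∀ {N} → ℕ → ℕ → ℕ → SP N
etEntry n zero c = ht c
etEntry n (suc r') c = if suc r' ℕ.≤ᵇ suc c then fromℕ (n ℕ.+ 2 ℕ.+ c ℕ.∸ 2 ℕ.* suc r') • h (suc c ℕ.∸ suc r') else 0sp

etEntry-lowerRow : ∀ {N} n R c → 1 ℕ.≤ R → etEntry {N} n R c ≡ (if R ℕ.≤ᵇ suc c then fromℕ (n ℕ.+ 2 ℕ.+ c ℕ.∸ 2 ℕ.* R) • h (suc c ℕ.∸ R) else 0sp)
etEntry-lowerRow n (suc r) c _ = refl

E²Entry : ∀ {N} → ℕ → ℕ → ℕ → SP N
E²Entry m r c = if r ℕ.≤ᵇ suc c then fromℕ (m ℕ.+ 1 ℕ.+ c ℕ.∸ 2 ℕ.* r) • h (suc c ℕ.∸ r) else 0sp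

etEntry-dropCorners : ∀ {N} n j → j ℕ.≤ n → ∀ r c → dropCorners (suc j) (etEntry {N} n) r c ≡ E²Entry (n ℕ.∸ j) r c
etEntry-dropCorners n j le r c =
  trans (dropCorners≡ (suc j) (etEntry n) r c) (trans (etEntry-lowerRow n (r ℕ.+ suc j) (c ℕ.+ suc j) (ℕP.≤-trans (ℕ.s≤s ℕ.z≤n) (ℕP.m≤n+m (suc j) r)))
  (trans (cong (λ b → if b then fromℕ (n ℕ.+ 2 ℕ.+ (c ℕ.+ suc j) ℕ.∸ 2 ℕ.* (r ℕ.+ suc j)) • h (suc (c ℕ.+ suc j) ℕ.∸ (r ℕ.+ suc j)) else 0sp) (≤ᵇ-+ʳ r (suc c) (suc j)))
         (cong₂ (λ u v → if r ℕ.≤ᵇ suc c then fromℕ u • h v else 0sp) (n+2+[c+1+j]∸2[r+1+j]≡[n∸j]+1+c∸2r n j c r le) ([m+o]∸[n+o]≡m∸n (suc c) r (suc j)))))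

E²Entry-dropCorners : ∀ {N} k t → t ℕ.≤ k → ∀ r c → dropCorners (suc t) (E²Entry {N} (suc k)) r c ≡ E²Entry (k ℕ.∸ t) r c
E²Entry-dropCorners k t le r c = trans (dropCorners≡ (suc t) (E²Entry (suc k)) r c)
  (trans (cong (λ b → if b then fromℕ (suc k ℕ.+ 1 ℕ.+ (c ℕ.+ suc t) ℕ.∸ 2 ℕ.* (r ℕ.+ suc t)) • h (suc (c ℕ.+ suc t) ℕ.∸ (r ℕ.+ suc t)) else 0sp) (≤ᵇ-+ʳ r (suc c) (suc t)))
         (cong₂ (λ u v → if r ℕ.≤ᵇ suc c then fromℕ u • h v else 0sp) ([1+k]+1+[c+1+t]∸2[r+1+t]≡[k∸t]+1+c∸2r k t c r le) ([m+o]∸[n+o]≡m∸n (suc c) r (suc t))))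

•-h0 : ∀ {N} q → (q • h {N} 0) ≋ (q • 1sp)
•-h0 q = •-cong q (≋-trans h0≋1 (•-identityˡ 1sp))

etEntry-zero : ∀ {N} n → ZeroBelowSubdiagonal (etEntry {N} n)
etEntry-zero n (suc r) c p rewrite ≰⇒≤ᵇ≡false {suc r} {suc c} (λ q → ℕP.<⇒≱ p q) = λ μ → refl

etEntry-subdiagonal : ∀ {N} n → ScalarSubdiagonal (etEntry {N} n) (λ x → fromℕ (suc n ℕ.∸ x))
etEntry-subdiagonal n r μ rewrite ≤⇒≤ᵇ≡true (ℕP.≤-refl {suc r}) | n+2+r∸2[1+r]≡n∸r n r | ℕP.n∸n≡0 r = •-h0 (fromℕ (n ℕ.∸ r)) μ

etEntry-bosonic : ∀ {N} n → BosonicBelowFirstRow (etEntry {N} n)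
etEntry-bosonic n r c = bosonic-if (suc r ℕ.≤ᵇ suc c) _ (bosonic-• (fromℕ (n ℕ.+ 2 ℕ.+ c ℕ.∸ 2 ℕ.* suc r)) (h-bosonic (suc c ℕ.∸ suc r)))

E²Entry-zero : ∀ {N} m → ZeroBelowSubdiagonal (E²Entry {N} m)
E²Entry-zero m r c p rewrite ≰⇒≤ᵇ≡false {r} {suc c} (λ q → ℕP.<⇒≱ p q) = λ μ → refl

E²Entry-subdiagonal : ∀ {N} k → ScalarSubdiagonal (E²Entry {N} (suc k)) (λ x → fromℕ (suc k ℕ.∸ x))
E²Entry-subdiagonal k r μ rewrite ≤⇒≤ᵇ≡true (ℕP.≤-refl {suc r}) | [1+k]+1+r∸2[1+r]≡k∸r k r | ℕP.n∸n≡0 r = •-h0 (fromℕ (k ℕ.∸ r)) μ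

E²Entry-bosonic : ∀ {N} m → BosonicBelowFirstRow (E²Entry {N} m)
E²Entry-bosonic m r c = bosonic-if (suc r ℕ.≤ᵇ suc c) _ (bosonic-• (fromℕ (m ℕ.+ 1 ℕ.+ c ℕ.∸ 2 ℕ.* suc r)) (h-bosonic (suc c ℕ.∸ suc r)))

prodUpTo-falling : ∀ k t → t ℕ.≤ k → prodUpTo (λ x → fromℕ (suc k ℕ.∸ x)) t * fromℕ ((k ℕ.∸ t) !) ≡ fromℕ (k !)
prodUpTo-falling k zero _ = ℚP.*-identityˡ (fromℕ (k !))
prodUpTo-falling (suc k) (suc t) (ℕ.s≤s le) = trans (ℚP.*-assoc (fromℕ (suc k)) (prodUpTo (λ x → fromℕ (suc k ℕ.∸ x)) t) (fromℕ ((k ℕ.∸ t) !)))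
  (trans (cong (fromℕ (suc k) *_) (prodUpTo-falling k t le)) (sym (fromℕ-* (suc k) (k !))))

binom2ᵥ-zero : ∀ {N} (α : Vec ℕ N) → (sumV α ℕ.≡ᵇ 0) ≡ true → binom2ᵥ α ≡ 1ℚ
binom2ᵥ-zero [] p = refl
binom2ᵥ-zero (zero ∷ α) p = trans (ℚP.*-identityˡ (binom2ᵥ α)) (binom2ᵥ-zero α p)

1≋E²0 : ∀ {N} → 1sp ≋ (fromℕ (0 !) • E² {N} 0)
1≋E²0 (α , S) = trans (cong (λ z → if z ∧ noneTrue S then 1ℚ else 0ℚ) (allZero≡sumV≡ᵇ0 α))
  (trans (lem (sumV α ℕ.≡ᵇ 0) (noneTrue S) (binom2ᵥ-zero α)) (sym (ℚP.*-identityˡ _)))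
  where
  lem : ∀ z s → (z ≡ true → binom2ᵥ α ≡ 1ℚ) → (if z ∧ s then 1ℚ else 0ℚ) ≡ (if s ∧ z then binom2ᵥ α else 0ℚ)
  lem true true p = sym (p refl)
  lem true false p = refl
  lem false true p = refl
  lem false false p = refl

•-*sp-•-• : ∀ {N} s a p q (H X : SP N) → (s • ((a • H) *sp (p • (q • X)))) ≋ (((p * q) * (s * a)) • (H *sp X))
•-*sp-•-• s a p q H X μ = begin
  s * ((a • H) *sp (p • (q • X))) μ ≡⟨ cong (s *_) (*sp-•ˡ a H (p • (q • X)) μ) ⟩
  s * (a * (H *sp (p • (q • X))) μ) ≡⟨ cong (λ z → s * (a * z)) (*sp-•ʳ p H (q • X) μ) ⟩
  s * (a * (p * (H *sp (q • X)) μ)) ≡⟨ cong (λ z → s * (a * (p * z))) (*sp-•ʳ q H X μ) ⟩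
  s * (a * (p * (q * (H *sp X) μ))) ≡⟨ solve 5 (λ s a p q x → s :* (a :* (p :* (q :* x))) := ((p :* q) :* (s :* a)) :* x) refl s a p q ((H *sp X) μ) ⟩
  ((p * q) * (s * a)) * (H *sp X) μ ∎
  where open ≡-Reasoning

•-*sp-• : ∀ {N} s p q (H X : SP N) → (s • (H *sp (p • (q • X)))) ≋ (((p * q) * s) • (H *sp X))
•-*sp-• s p q H X μ = begin
  s * (H *sp (p • (q • X))) μ ≡⟨ cong (s *_) (*sp-•ʳ p H (q • X) μ) ⟩
  s * (p * (H *sp (q • X)) μ) ≡⟨ cong (λ z → s * (p * z)) (*sp-•ʳ q H X μ) ⟩
  s * (p * (q * (H *sp X) μ)) ≡⟨ solve 4 (λ s p q x → s :* (p :* (q :* x)) := ((p :* q) :* s) :* x) refl s p q ((H *sp X) μ) ⟩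
  ((p * q) * s) * (H *sp X) μ ∎
  where open ≡-Reasoning

det-E²Matrix : ∀ {N} n m → m ℕ.≤ n → det (toMatrix (E²Entry {N} m) m) ≋ (fromℕ (m !) • E² m)
det-E²Matrix n zero _ = 1≋E²0
det-E²Matrix {N} (suc n) (suc k) (ℕ.s≤s k≤n) = begin
  det (toMatrix (E²Entry (suc k)) (suc k))
    ≈⟨ det-hessenberg k (E²Entry (suc k)) d (E²Entry-zero (suc k)) (E²Entry-subdiagonal k) (E²Entry-bosonic (suc k)) ⟩
  sumSP (map (hessenbergTerm k (E²Entry (suc k)) d) (upTo (suc k)))
    ≈⟨ sumSP-cong-upTo (suc k) (hessenbergTerm k (E²Entry (suc k)) d) (λ t → (fromℕ (k !) * E²-weight k t) • (h (suc t) *sp E² (k ℕ.∸ t))) term≋ ⟩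
  sumSP (map (λ t → (fromℕ (k !) * E²-weight k t) • (h (suc t) *sp E² (k ℕ.∸ t))) (upTo (suc k)))
    ≈⟨ ≋-sym (≋-trans (•-sumSP (fromℕ (k !)) (upTo (suc k)) (λ t → E²-weight k t • (h (suc t) *sp E² (k ℕ.∸ t))))
                      (sumSP-cong (upTo (suc k)) _ _ (λ t → •-assoc (fromℕ (k !)) (E²-weight k t) (h (suc t) *sp E² (k ℕ.∸ t))))) ⟩
  (fromℕ (k !) • sumSP (map (λ t → E²-weight k t • (h (suc t) *sp E² (k ℕ.∸ t))) (upTo (suc k)))) ≈⟨ •-cong (fromℕ (k !)) (E²-convolution k) ⟩
  (fromℕ (k !) • (fromℕ (suc k) • E² (suc k))) ≈⟨ •-assoc (fromℕ (k !)) (fromℕ (suc k)) (E² (suc k)) ⟩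
  ((fromℕ (k !) * fromℕ (suc k)) • E² (suc k))
    ≈⟨ (λ μ → cong (_* E² (suc k) μ) (trans (ℚP.*-comm (fromℕ (k !)) (fromℕ (suc k))) (sym (fromℕ-* (suc k) (k !))))) ⟩
  (fromℕ (suc k !) • E² (suc k)) ∎
  where
  open import Relation.Binary.Reasoning.Setoid (≋-setoid N)
  d : ℕ → ℚ
  d x = fromℕ (suc k ℕ.∸ x)
  term≋ : ∀ t → t ℕ.< suc k → hessenbergTerm k (E²Entry (suc k)) d t ≋ ((fromℕ (k !) * E²-weight k t) • (h (suc t) *sp E² (k ℕ.∸ t)))
  term≋ t (ℕ.s≤s t≤k) = ≋-trans
    (•-cong (sgn t) (*sp-cong (≋-refl {f = E²Entry (suc k) 0 t}) (•-cong (prodUpTo d t)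
       (≋-trans (det-cong _ (toMatrix (E²Entry (k ℕ.∸ t)) (k ℕ.∸ t)) (λ r c μ → cong (λ f → f μ) (E²Entry-dropCorners k t t≤k (toℕ r) (toℕ c))))
                (det-E²Matrix n (k ℕ.∸ t) (ℕP.≤-trans (ℕP.m∸n≤m k t) k≤n))))))
    (≋-trans (•-*sp-•-• (sgn t) (fromℕ (suc k ℕ.+ 1 ℕ.+ t)) (prodUpTo d t) (fromℕ ((k ℕ.∸ t) !)) (h (suc t)) (E² (k ℕ.∸ t)))
       (λ μ → cong (_* (h (suc t) *sp E² (k ℕ.∸ t)) μ) (cong (_* (sgn t * fromℕ (suc k ℕ.+ 1 ℕ.+ t))) (prodUpTo-falling k t t≤k))))
1/[1+x]*[1+x]≡1 : ∀ x → (ℤ.+ 1 ℚ./ suc x) * fromℕ (suc x) ≡ 1ℚ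
1/[1+x]*[1+x]≡1 x = trans (cong₂ _*_ (ℚP.normalize-coprime (C.1-coprimeTo (suc x))) (fromℕ≡mkℚ (suc x))) (ℚP.*-inverseˡ (mkℚ (ℤ.+ suc x) 0 (C.sym (C.1-coprimeTo (suc x)))))

1/d*d≡1 : ∀ d .{{_ : ℕ.NonZero d}} → (ℤ.+ 1 ℚ./ d) * fromℕ d ≡ 1ℚ
1/d*d≡1 (suc x) = 1/[1+x]*[1+x]≡1 x

invFact*n!≡1 : ∀ n → invFact n * fromℕ (n !) ≡ 1ℚ
invFact*n!≡1 n = 1/d*d≡1 (n !) {{n ℕP.!≢0}}

det-EtMat≋toMatrix : ∀ {N} n → det (EtMat N n) ≋ det (toMatrix (etEntry {N} n) (suc n))
det-EtMat≋toMatrix n = det-cong _ _ pt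
  where pt : ∀ r c → EtMat _ n r c ≋ toMatrix (etEntry n) (suc n) r c
        pt F.zero c = ≋-refl
        pt (F.suc r) c = ≋-refl

det-EtMat : ∀ {N} n → det (EtMat N n) ≋ (fromℕ (n !) • et n)
det-EtMat {N} n = begin
  det (EtMat N n) ≈⟨ det-EtMat≋toMatrix n ⟩
  det (toMatrix (etEntry n) (suc n)) ≈⟨ det-hessenberg n (etEntry n) d (etEntry-zero n) (etEntry-subdiagonal n) (etEntry-bosonic n) ⟩
  sumSP (map (hessenbergTerm n (etEntry n) d) (upTo (suc n)))
    ≈⟨ sumSP-cong-upTo (suc n) (hessenbergTerm n (etEntry n) d) (λ j → (fromℕ (n !) * sgn j) • (ht j *sp E² (n ℕ.∸ j))) term≋ ⟩
  sumSP (map (λ j → (fromℕ (n !) * sgn j) • (ht j *sp E² (n ℕ.∸ j))) (upTo (suc n)))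
    ≈⟨ ≋-sym (≋-trans (•-sumSP (fromℕ (n !)) (upTo (suc n)) (λ j → sgn j • (ht j *sp E² (n ℕ.∸ j))))
                      (sumSP-cong (upTo (suc n)) _ _ (λ j → •-assoc (fromℕ (n !)) (sgn j) (ht j *sp E² (n ℕ.∸ j))))) ⟩
  (fromℕ (n !) • sumSP (map (λ j → sgn j • (ht j *sp E² (n ℕ.∸ j))) (upTo (suc n)))) ≈⟨ •-cong (fromℕ (n !)) (et-convolution n) ⟩
  (fromℕ (n !) • et n) ∎
  where
  open import Relation.Binary.Reasoning.Setoid (≋-setoid N)
  d : ℕ → ℚ
  d x = fromℕ (suc n ℕ.∸ x)
  term≋ : ∀ j → j ℕ.< suc n → hessenbergTerm n (etEntry n) d j ≋ ((fromℕ (n !) * sgn j) • (ht j *sp E² (n ℕ.∸ j)))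
  term≋ j (ℕ.s≤s j≤n) = ≋-trans
    (•-cong (sgn j) (*sp-cong (≋-refl {f = ht j}) (•-cong (prodUpTo d j)
       (≋-trans (det-cong _ (toMatrix (E²Entry (n ℕ.∸ j)) (n ℕ.∸ j)) (λ r c μ → cong (λ f → f μ) (etEntry-dropCorners n j j≤n (toℕ r) (toℕ c))))
                (det-E²Matrix n (n ℕ.∸ j) (ℕP.m∸n≤m n j))))))
    (≋-trans (•-*sp-• (sgn j) (prodUpTo d j) (fromℕ ((n ℕ.∸ j) !)) (ht j) (E² (n ℕ.∸ j)))
       (λ μ → cong (_* (ht j *sp E² (n ℕ.∸ j)) μ) (cong (_* sgn j) (prodUpTo-falling n j j≤n))))

invFact•det-EtMat : ∀ {N} n → (invFact n • det (EtMat N n)) ≋ et n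
invFact•det-EtMat n μ = begin
  invFact n * det (EtMat _ n) μ ≡⟨ cong (invFact n *_) (det-EtMat n μ) ⟩
  invFact n * (fromℕ (n !) * et n μ) ≡⟨ sym (ℚP.*-assoc (invFact n) (fromℕ (n !)) (et n μ)) ⟩
  (invFact n * fromℕ (n !)) * et n μ ≡⟨ cong (_* et n μ) (invFact*n!≡1 n) ⟩
  1ℚ * et n μ ≡⟨ ℚP.*-identityˡ (et n μ) ⟩
  et n μ ∎
  where open ≡-Reasoning

proposition3p5 : ((N n : ℕ) → 1 ≤ n → e {N} n ≋ det (EMat N n))
    × ((N n : ℕ) → et {N} n ≋ (invFact n • det (EtMat N n)))
proposition3p5 = (λ N n _ → ≋-sym (det-eMatrix n n ℕP.≤-refl)) , (λ N n → ≋-sym (invFact•det-EtMat n))
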